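{- Let $n\ge1$, $m\ge1$, let $V_1,\dots,V_{n+1}$ be pairwise disjoint sets each of size $m$, and let $X_{n,m}$ be the simplicial complex on $V_1\cup\dots\cup V_{n+1}$ whose simplices are the sets $\sigma$ with $|\sigma\cap V_i|\le1$ for all $i$. Let $0\le k\le n-1$. If $k+2$ divides $m$, then $h_k(X_{n,m})\le 1$.
   Context: For a finite pure $n$-dimensional complex $X$ with $k$-faces $X(k)$, $f_k(X)=|X(k)|$: for $\sigma\in X(k)$, $c(\sigma)$ is the number of $n$-faces containing $\sigma$ and $w(\sigma)=c(\sigma)/\big(\binom{n+1}{k+1}f_n(X)\big)$. Cochains are $\mathbb{F}_2$-valued; $d_k$ is the coboundary, with the augmented convention ($C^{ -1}=\mathbb{F}_2^{\{\emptyset\}}$, $d_{ -1}\psi(v)=\psi(\emptyset)$), $B^k(X)=d_{k-1}C^{k-1}(X)$. For $\phi\in C^k(X)$, $\|\phi\|=\sum_{\sigma:\phi(\sigma)\ne0}w(\sigma)$, $\|[\phi]\|=\min_{\psi}\|\phi+d_{k-1}\psi\|$, and $h_k(X)=\min\{\|d_k\phi\|/\|[\phi]\|:\phi\in C^k(X)\setminus B^k(X)\}$. -}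

module Defs where

open import Data.Bool using (Bool; true; false; _∧_; _∨_; _xor_; if_then_else_; not)
open import Data.Nat as ℕ using (ℕ; zero; suc; _≡ᵇ_; _≤ᵇ_)
open import Data.Nat.Combinatorics using (_C_)
open import Data.Integer using (+_)
open import Data.Fin using (Fin)
import Data.Fin.Properties as FinP
open import Data.Fin.Subset using (Subset; ∣_∣; _∩_)
open import Data.List using (List; []; _∷_; _++_; map; foldr; length; concatMap; allFin)
open import Data.Bool.ListAction using (and; or)
open import Data.Vec using (Vec; []; _∷_; tabulate)
import Data.Vec.Properties as VecP
import Data.Bool.Properties as BoolP
open import Data.Rational using (ℚ; 0ℚ; 1ℚ; _/_; _+_; _⊓_; _÷_; _≤_; ≢-nonZero)
import Data.Rational.Properties as ℚP
open import Relation.Nullary using (yes; no; does)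
open import Relation.Binary.PropositionalEquality using (_≡_)

-- A face is a subset of Fin N; a k-face is a face of size k+1
-- (the empty face, of size 0, is the unique (-1)-face: augmented convention).

record Complex : Set where
  field
    N      : ℕ
    dim    : ℕ            -- the dimension n of the (pure) complex
    member : Subset N → Bool

open Complex public

filterᵇ : {A : Set} → (A → Bool) → List A → List A
filterᵇ p [] = []
filterᵇ p (x ∷ xs) = if p x then x ∷ filterᵇ p xs else filterᵇ p xs

allSubsets : (N : ℕ) → List (Subset N)
allSubsets zero = [] ∷ []
allSubsets (suc N) = concatMap (λ s → (false ∷ s) ∷ (true ∷ s) ∷ []) (allSubsets N)

_⊆ᵇ_ : {N : ℕ} → Subset N → Subset N → Bool
[] ⊆ᵇ [] = true
(x ∷ xs) ⊆ᵇ (y ∷ ys) = (not x ∨ y) ∧ (xs ⊆ᵇ ys)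

_==ˢ_ : {N : ℕ} → Subset N → Subset N → Bool
s ==ˢ t = does (VecP.≡-dec BoolP._≟_ s t)

-- faces of X of size s, i.e. the (s-1)-faces X(s-1)
faces : (X : Complex) → ℕ → List (Subset (N X))
faces X s = filterᵇ (λ σ → member X σ ∧ (∣ σ ∣ ≡ᵇ s)) (allSubsets (N X))

-- F₂-valued cochains: functions on subsets (only their values on faces
-- of the relevant dimension matter).
Cochain : Complex → Set
Cochain X = Subset (N X) → Bool

-- all cochains supported on a given list of faces (all F₂-valued
-- functions on that list, extended by 0)
allCochains : (X : Complex) → List (Subset (N X)) → List (Cochain X)
allCochains X [] = (λ _ → false) ∷ []
allCochains X (f ∷ fs) =
  concatMap (λ g → g ∷ (λ σ → if σ ==ˢ f then true else g σ) ∷ [])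
            (allCochains X fs)

-- the coboundary of a cochain ψ on faces of size j (a (j-1)-cochain):
-- (dψ)(τ) = Σ_{σ ⊂ τ, |σ| = j} ψ(σ)  (mod 2).
-- d_{j-1} ψ is meaningful on faces of size j+1; j = 0 gives d_{-1}ψ(v) = ψ(∅).
cobd : (X : Complex) → ℕ → Cochain X → Cochain X
cobd X j ψ τ = foldr (λ σ b → (ψ σ ∧ (σ ⊆ᵇ τ)) xor b) false (faces X j)

_⊕_ : {X : Complex} → Cochain X → Cochain X → Cochain X
(φ ⊕ ψ) σ = φ σ xor ψ σ

-- division of naturals into ℚ (the denominator is never 0 where used
-- for the complexes below; 0 is returned in that degenerate case)
divℕ : ℕ → ℕ → ℚ
divℕ a zero = 0ℚ
divℕ a (suc d) = (+ a) / suc d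

-- rational division, with x / 0 := 0 (only used with nonzero denominators)
divℚ : ℚ → ℚ → ℚ
divℚ p q with q ℚP.≟ 0ℚ
... | yes _ = 0ℚ
... | no q≢0 = _÷_ p q {{≢-nonZero q≢0}}

c : (X : Complex) → Subset (N X) → ℕ
c X σ = length (filterᵇ (σ ⊆ᵇ_) (faces X (suc (dim X))))

fTop : Complex → ℕ
fTop X = length (faces X (suc (dim X)))

w : (X : Complex) → ℕ → Subset (N X) → ℚ
w X s σ = divℕ (c X σ) (((suc (dim X)) C s) ℕ.* fTop X)

sumℚ : List ℚ → ℚ
sumℚ = foldr _+_ 0ℚ

norm : (X : Complex) → ℕ → Cochain X → ℚ
norm X s φ = sumℚ (map (w X s) (filterᵇ φ (faces X s)))

classNorm : (X : Complex) → (k : ℕ) → Cochain X → ℚ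
classNorm X k φ =
  foldr _⊓_ (norm X (suc k) φ)
    (map (λ ψ → norm X (suc k) (_⊕_ {X} φ (cobd X k ψ))) (allCochains X (faces X k)))

inB : (X : Complex) → (k : ℕ) → Cochain X → Bool
inB X k φ =
  or (map (λ ψ → and (map (λ σ → does (BoolP._≟_ (φ σ) (cobd X k ψ σ))) (faces X (suc k))))
          (allCochains X (faces X k)))

-- ℚ extended by +∞ (the minimum of the empty set)
data ℚ∞ : Set where
  fin : ℚ → ℚ∞
  ∞   : ℚ∞

_⊓∞_ : ℚ∞ → ℚ∞ → ℚ∞
fin p ⊓∞ fin q = fin (p ⊓ q)
fin p ⊓∞ ∞ = fin p
∞ ⊓∞ y = y

data _≤∞_ : ℚ∞ → ℚ∞ → Set where
  fin≤fin : ∀ {p q} → p ≤ q → fin p ≤∞ fin q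
  le-∞    : ∀ {x} → x ≤∞ ∞

h : (X : Complex) → ℕ → ℚ∞
h X k =
  foldr _⊓∞_ ∞
    (map (λ φ → fin (divℚ (norm X (suc (suc k)) (cobd X (suc k) φ)) (classNorm X k φ)))
         (filterᵇ (λ φ → not (inB X k φ)) (allCochains X (faces X (suc k)))))

-- The complex X_{n,m}.
-- The vertex set is Fin N, partitioned into the n+1 parts
-- V_i = part⁻¹(i), i : Fin (n+1)  (each required to have size m in the claim).

block : {N n : ℕ} → (Fin N → Fin (suc n)) → Fin (suc n) → Subset N
block part i = tabulate (λ v → does (FinP._≟_ (part v) i))

Xnm : (n N : ℕ) → (Fin N → Fin (suc n)) → Complex
Xnm n N part = record
  { N = N
  ; dim = n
  ; member = λ σ → and (map (λ i → ∣ σ ∩ block part i ∣ ≤ᵇ 1) (allFin (suc n)))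
  }

-- Colour every block with the colours 0, …, k+1, each used q = m/(k+2) times (the colour of a vertex
-- is its rank inside its block modulo k+2), and let φ be the indicator of the k-faces that use every
-- colour except the last one exactly once. A (k+1)-face has an odd number of facets in supp φ exactly
-- when it is rainbow, so dφ is the indicator of the rainbow (k+1)-faces; in particular φ is not a
-- coboundary. If φ′ = φ + dψ, every rainbow face contains a k-face of supp φ′, while a k-face lies in
-- at most q(n−k) rainbow faces. Since c(σ) = m^(n+1−|σ|) and f_n = m^(n+1), this double count is
-- exactly ‖dφ‖ ≤ ‖φ′‖, so ‖dφ‖ ≤ ‖[φ]‖ and h_k ≤ 1.

module Submission where

open import Defs
open import Data.Bool using (Bool; true; false; _∧_; _∨_; _xor_; if_then_else_; not)
open import Data.Bool.ListAction using (and; or)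
open import Data.Bool.Properties as BoolP
  using (not-involutive; not-injective; xor-identityʳ; ∧-conicalˡ; ∧-conicalʳ; ∧-identityʳ; ∧-zeroʳ; ∧-assoc; ∧-comm; T-≡)
open import Data.Bool.Solver using (module ∨-∧-Solver; module xor-∧-Solver)
import Data.Integer as ℤ
import Data.Integer.Properties as ℤP
import Data.Integer.Tactic.RingSolver as ℤ-Solver
open import Data.Fin using (Fin; toℕ; fromℕ; fromℕ<) renaming (zero to fz; suc to fs)
import Data.Fin.Properties as FinP
open import Data.Fin.Subset using (Subset; ∣_∣; _∩_; ⊥; ⊤)
open import Data.Fin.Subset.Properties using (∩-identityʳ; ∩-zeroˡ; ∣⊥∣≡0)
open import Data.List using (List; []; _∷_; map; foldr; length; concatMap; allFin)
open import Data.List.Membership.Propositional using (_∈_; lose)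
open import Data.List.Membership.Propositional.Properties using (∈-allFin; ∈-concatMap⁺)
open import Data.List.Relation.Unary.Any using (here; there)
open import Data.Nat as ℕ using (ℕ; zero; suc; _+_; _*_; _∸_; _^_; _%_; _≤_; _<_; _≡ᵇ_; _<ᵇ_; _≤ᵇ_; z≤n; s≤s)
import Data.Nat.Properties as ℕP
open import Algebra.Properties.Semiring.Sum ℕP.+-*-semiring
  using (sum; sum-syntax; sum-cong-≗; ∑-distrib-+; ∑-comm; *-distribˡ-sum; *-distribʳ-sum)
open import Data.Nat.Combinatorics using (_C_; nC1≡n; nCk+nC[k+1]≡[n+1]C[k+1])
open import Data.Nat.Combinatorics.Specification using (k>n⇒nCk≡0)
open import Data.Nat.DivMod using (m<n⇒m%n≡m; [m+n]%n≡m%n; m%n<n)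
open import Data.Nat.Divisibility using (_∣_; divides)
open import Data.Nat.Tactic.RingSolver using (solve-∀)
open import Data.Product as Product using (Σ; _×_; _,_; proj₁; proj₂)
open import Data.Rational as ℚ using (ℚ; mkℚ; 0ℚ; 1ℚ; toℚᵘ; NonZero; Positive; NonNegative; ≢-nonZero; positive)
import Data.Rational.Properties as ℚP
open import Data.Rational.Unnormalised as ℚᵘ using (mkℚᵘ; *≡*; *≤*)
import Data.Rational.Unnormalised.Properties as ℚᵘP
open import Data.Vec using ([]; _∷_; lookup; tabulate; _[_]≔_)
open import Data.Vec.Properties as VecP using (lookup∘tabulate; lookup-zipWith)
open import Function using (_∘_)
open import Function.Bundles using (Equivalence)
open import Relation.Nullary using (Dec; yes; no; does; contradiction)
open import Relation.Nullary.Decidable using (dec-true; dec-false)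
open import Relation.Binary.PropositionalEquality


𝟙 : Bool → ℕ
𝟙 true = 1
𝟙 false = 0

𝟙-∧ : ∀ a b → 𝟙 (a ∧ b) ≡ 𝟙 b * 𝟙 a
𝟙-∧ true b = sym (ℕP.*-identityʳ (𝟙 b))
𝟙-∧ false b = sym (ℕP.*-zeroʳ (𝟙 b))

𝟙≤1 : ∀ b → 𝟙 b ≤ 1
𝟙≤1 true = s≤s z≤n
𝟙≤1 false = z≤n

𝟙≡0⇒false : ∀ {b} → 𝟙 b ≡ 0 → b ≡ false
𝟙≡0⇒false {false} _ = refl

𝟙>0⇒true : ∀ {b} → 0 < 𝟙 b → b ≡ true
𝟙>0⇒true {true} _ = refl

𝟙-mono : ∀ {a b} → (a ≡ true → b ≡ true) → 𝟙 a ≤ 𝟙 b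
𝟙-mono {false} _ = z≤n
𝟙-mono {true} a⇒b rewrite a⇒b refl = ℕP.≤-refl

parity : ℕ → Bool
parity zero = false
parity (suc n) = not (parity n)

parity-+ : ∀ a b → parity (a + b) ≡ parity a xor parity b
parity-+ zero b = refl
parity-+ (suc a) b rewrite parity-+ a b with parity a
... | true = not-involutive (parity b)
... | false = refl

parity-𝟙 : ∀ b → parity (𝟙 b) ≡ b
parity-𝟙 true = refl
parity-𝟙 false = refl

parity-𝟙* : ∀ b a → parity (𝟙 b * a) ≡ b ∧ parity a
parity-𝟙* true a = cong parity (ℕP.+-identityʳ a)
parity-𝟙* false a = refl

parity-true⇒pos : ∀ {a} → parity a ≡ true → 0 < a
parity-true⇒pos {suc a} _ = s≤s z≤n

≡ᵇ-true⇒≡ : ∀ a b → (a ≡ᵇ b) ≡ true → a ≡ b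
≡ᵇ-true⇒≡ a b e = ℕP.≡ᵇ⇒≡ a b (Equivalence.from T-≡ e)

≡⇒≡ᵇ-true : ∀ a b → a ≡ b → (a ≡ᵇ b) ≡ true
≡⇒≡ᵇ-true a b e = Equivalence.to T-≡ (ℕP.≡⇒≡ᵇ a b e)

≢⇒≡ᵇ-false : ∀ a b → a ≢ b → (a ≡ᵇ b) ≡ false
≢⇒≡ᵇ-false a b a≢b with a ≡ᵇ b in e
... | false = refl
... | true = contradiction (≡ᵇ-true⇒≡ a b e) a≢b

<ᵇ-true⇒< : ∀ a b → (a <ᵇ b) ≡ true → a < b
<ᵇ-true⇒< a b e = ℕP.<ᵇ⇒< a b (Equivalence.from T-≡ e)

<⇒<ᵇ-true : ∀ a b → a < b → (a <ᵇ b) ≡ true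
<⇒<ᵇ-true a b p = Equivalence.to T-≡ (ℕP.<⇒<ᵇ p)

≤ᵇ-true⇒≤ : ∀ a b → (a ≤ᵇ b) ≡ true → a ≤ b
≤ᵇ-true⇒≤ a b e = ℕP.≤ᵇ⇒≤ a b (Equivalence.from T-≡ e)

≤⇒≤ᵇ-true : ∀ a b → a ≤ b → (a ≤ᵇ b) ≡ true
≤⇒≤ᵇ-true a b p = Equivalence.to T-≡ (ℕP.≤⇒≤ᵇ p)

does-true⇒ : {P : Set} (p? : Dec P) → does p? ≡ true → P
does-true⇒ (yes p) e = p

does-Fin-≟ : ∀ {K} (a b : Fin K) → does (a FinP.≟ b) ≡ (toℕ a ≡ᵇ toℕ b)
does-Fin-≟ a b with a FinP.≟ b
... | yes refl = sym (≡⇒≡ᵇ-true (toℕ a) (toℕ a) refl)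
... | no a≢b = sym (≢⇒≡ᵇ-false (toℕ a) (toℕ b) (λ e → a≢b (FinP.toℕ-injective e)))

∑-const : ∀ N a → ∑[ i < N ] a ≡ N * a
∑-const zero a = refl
∑-const (suc N) a = cong (a +_) (∑-const N a)

∑-0 : ∀ {N} {f : Fin N → ℕ} → (∀ i → f i ≡ 0) → sum f ≡ 0
∑-0 {N} e = trans (sum-cong-≗ e) (trans (∑-const N 0) (ℕP.*-zeroʳ N))

∑-mono-≤ : ∀ {N} {f g : Fin N → ℕ} → (∀ i → f i ≤ g i) → sum f ≤ sum g
∑-mono-≤ {zero} e = z≤n
∑-mono-≤ {suc N} e = ℕP.+-mono-≤ (e fz) (∑-mono-≤ (λ i → e (fs i)))

∑-≤-size : ∀ {N} {f : Fin N → ℕ} → (∀ i → f i ≤ 1) → sum f ≤ N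
∑-≤-size {N} {f} le = subst (sum f ≤_) (trans (∑-const N 1) (ℕP.*-identityʳ N)) (∑-mono-≤ le)

∑-δ : ∀ {N} (p : Fin N) (f : Fin N → ℕ) → ∑[ i < N ] (𝟙 (does (p FinP.≟ i)) * f i) ≡ f p
∑-δ {suc N} fz f = trans (cong₂ _+_ (ℕP.+-identityʳ (f fz)) (∑-0 {N} {λ _ → 0} (λ _ → refl))) (ℕP.+-identityʳ _)
∑-δ {suc N} (fs p) f = trans (sum-cong-≗ shift) (∑-δ p (λ i → f (fs i)))
  where
  shift : ∀ i → 𝟙 (does (fs p FinP.≟ fs i)) * f (fs i) ≡ 𝟙 (does (p FinP.≟ i)) * f (fs i)
  shift i with p FinP.≟ i
  ... | yes _ = refl
  ... | no _ = refl

∑-𝟙-<ᵇ : ∀ {A} c → c ≤ A → ∑[ i < A ] 𝟙 (toℕ i <ᵇ c) ≡ c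
∑-𝟙-<ᵇ {A} zero _ = ∑-0 {A} {λ i → 𝟙 (toℕ i <ᵇ 0)} (λ _ → refl)
∑-𝟙-<ᵇ {suc A} (suc c) (s≤s c≤A) = cong suc (∑-𝟙-<ᵇ c c≤A)

∑-pos⇒∃ : ∀ {N} (f : Fin N → ℕ) → 0 < sum f → Σ (Fin N) (λ i → 0 < f i)
∑-pos⇒∃ {suc N} f p with f fz in eq
... | suc _ = fz , subst (0 <_) (sym eq) (s≤s z≤n)
... | zero with ∑-pos⇒∃ (λ i → f (fs i)) p
... | i , q = fs i , q

∑-𝟙∧-pos⇒∃ : ∀ {N} (a b : Fin N → Bool) → 0 < ∑[ u < N ] 𝟙 (a u ∧ b u) → Σ (Fin N) λ u → a u ≡ true × b u ≡ true
∑-𝟙∧-pos⇒∃ a b pos with ∑-pos⇒∃ (λ u → 𝟙 (a u ∧ b u)) pos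
... | u , 0<𝟙 = u , both (a u) (b u) 0<𝟙
  where
  both : ∀ x y → 0 < 𝟙 (x ∧ y) → x ≡ true × y ≡ true
  both true true _ = refl , refl

∑≡0⇒≡0 : ∀ {N} (f : Fin N → ℕ) → sum f ≡ 0 → ∀ i → f i ≡ 0
∑≡0⇒≡0 f e fz = ℕP.m+n≡0⇒m≡0 (f fz) e
∑≡0⇒≡0 f e (fs i) = ∑≡0⇒≡0 (λ i → f (fs i)) (ℕP.m+n≡0⇒n≡0 (f fz) e) i

∑≡N⇒≡1 : ∀ {N} (f : Fin N → ℕ) → sum f ≡ N → (∀ i → f i ≤ 1) → ∀ i → f i ≡ 1
∑≡N⇒≡1 {suc N} f e le i with f fz in eq | le fz
... | zero | _ = contradiction (subst (_≤ N) e (∑-≤-size (λ j → le (fs j)))) ℕP.1+n≰n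
... | suc (suc _) | s≤s ()
... | suc zero | _ with i
...   | fz = eq
...   | fs j = ∑≡N⇒≡1 (λ j → f (fs j)) (ℕP.suc-injective e) (λ j → le (fs j)) j

∑<N⇒∃≡0 : ∀ {N} (f : Fin N → ℕ) → sum f < N → Σ (Fin N) (λ i → f i ≡ 0)
∑<N⇒∃≡0 {suc N} f p with f fz in eq
... | zero = fz , eq
... | suc x with ∑<N⇒∃≡0 (λ j → f (fs j)) (ℕP.≤-trans (s≤s (ℕP.m≤n+m _ x)) (ℕP.≤-pred p))
... | j , q = fs j , q

∑-zeros : ∀ {A} (f : Fin A → ℕ) → (∀ i → f i ≤ 1) → ∑[ i < A ] 𝟙 (f i ≡ᵇ 0) + sum f ≡ A
∑-zeros {A} f f≤1 = trans (sym (∑-distrib-+ (λ i → 𝟙 (f i ≡ᵇ 0)) f)) (trans (sum-cong-≗ one) (trans (∑-const A 1) (ℕP.*-identityʳ A)))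
  where
  one : ∀ i → 𝟙 (f i ≡ᵇ 0) + f i ≡ 1
  one i with f i | f≤1 i
  ... | zero | _ = refl
  ... | suc zero | _ = refl
  ... | suc (suc _) | s≤s ()

∑-fibres : ∀ {N A B} (g : Fin N → Fin A) (h : Fin N → Fin B) (f : Fin A → Fin B → ℕ) →
  ∑[ v < N ] f (g v) (h v) ≡ ∑[ i < A ] ∑[ j < B ] (f i j * ∑[ v < N ] 𝟙 (does (g v FinP.≟ i) ∧ does (h v FinP.≟ j)))
∑-fibres {N} {A} {B} g h f = begin
  ∑[ v < N ] f (g v) (h v)
    ≡⟨ sum-cong-≗ (λ v → sym (trans (sum-cong-≗ (λ i → cong (𝟙 (does (g v FinP.≟ i)) *_) (∑-δ (h v) (f i))))
                                      (∑-δ (g v) (λ i → f i (h v))))) ⟩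
  ∑[ v < N ] ∑[ i < A ] (𝟙 (does (g v FinP.≟ i)) * ∑[ j < B ] (𝟙 (does (h v FinP.≟ j)) * f i j))
    ≡⟨ ∑-comm (λ v i → 𝟙 (does (g v FinP.≟ i)) * ∑[ j < B ] (𝟙 (does (h v FinP.≟ j)) * f i j)) ⟩
  ∑[ i < A ] ∑[ v < N ] (𝟙 (does (g v FinP.≟ i)) * ∑[ j < B ] (𝟙 (does (h v FinP.≟ j)) * f i j))
    ≡⟨ sum-cong-≗ (λ i → trans (sum-cong-≗ (λ v → *-distribˡ-sum (𝟙 (does (g v FinP.≟ i))) (λ j → 𝟙 (does (h v FinP.≟ j)) * f i j)))
                               (∑-comm (λ v j → 𝟙 (does (g v FinP.≟ i)) * (𝟙 (does (h v FinP.≟ j)) * f i j)))) ⟩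
  ∑[ i < A ] ∑[ j < B ] ∑[ v < N ] (𝟙 (does (g v FinP.≟ i)) * (𝟙 (does (h v FinP.≟ j)) * f i j))
    ≡⟨ sum-cong-≗ (λ i → sum-cong-≗ (λ j → trans (sum-cong-≗ (λ v → reorder (does (g v FinP.≟ i)) (does (h v FinP.≟ j)) (f i j)))
                                                   (sym (*-distribˡ-sum (f i j) (λ v → 𝟙 (does (g v FinP.≟ i) ∧ does (h v FinP.≟ j))))))) ⟩
  ∑[ i < A ] ∑[ j < B ] (f i j * ∑[ v < N ] 𝟙 (does (g v FinP.≟ i) ∧ does (h v FinP.≟ j))) ∎
  where
  open ≡-Reasoning
  reorder : ∀ a b x → 𝟙 a * (𝟙 b * x) ≡ x * 𝟙 (a ∧ b)
  reorder a b x rewrite 𝟙-∧ a b = *-reorder (𝟙 a) (𝟙 b) x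
    where
    *-reorder : ∀ y z x → y * (z * x) ≡ x * (z * y)
    *-reorder = solve-∀

+-interchange : ∀ a b c d → (a + b) + (c + d) ≡ (a + c) + (b + d)
+-interchange = solve-∀

cross-multiply : ∀ a b K M y f c₁ c₂ r → c₁ * suc r ≡ c₂ * K → a * K ≤ b * (M * suc r) →
  a * y * (c₁ * f) ≤ b * (M * y) * (c₂ * f)
cross-multiply a b K M y f c₁ c₂ r c₁[r+1]≡c₂K aK≤ = ℕP.*-cancelʳ-≤ _ _ (suc r) (begin
  a * y * (c₁ * f) * suc r    ≡⟨ ring₁ a y c₁ f (suc r) ⟩
  a * y * f * (c₁ * suc r)    ≡⟨ cong (a * y * f *_) c₁[r+1]≡c₂K ⟩
  a * y * f * (c₂ * K)        ≡⟨ ring₂ a y c₂ f K ⟩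
  (a * K) * (y * c₂ * f)      ≤⟨ ℕP.*-monoˡ-≤ (y * c₂ * f) aK≤ ⟩
  b * (M * suc r) * (y * c₂ * f) ≡⟨ ring₃ b M (suc r) y c₂ f ⟩
  b * (M * y) * (c₂ * f) * suc r ∎)
  where
  open ℕP.≤-Reasoning
  ring₁ : ∀ a y c f s → a * y * (c * f) * s ≡ a * y * f * (c * s)
  ring₁ = solve-∀
  ring₂ : ∀ a y c f K → a * y * f * (c * K) ≡ (a * K) * (y * c * f)
  ring₂ = solve-∀
  ring₃ : ∀ b M s y c f → b * (M * s) * (y * c * f) ≡ b * (M * y) * (c * f) * s
  ring₃ = solve-∀

private variable A B : Set

and-map⇒ : (f : A → Bool) (xs : List A) → and (map f xs) ≡ true → ∀ {x} → x ∈ xs → f x ≡ true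
and-map⇒ f (y ∷ ys) e (here refl) = ∧-conicalˡ (f y) _ e
and-map⇒ f (y ∷ ys) e (there x∈) = and-map⇒ f ys (∧-conicalʳ (f y) _ e) x∈

and-map⇐ : (f : A → Bool) (xs : List A) → (∀ x → f x ≡ true) → and (map f xs) ≡ true
and-map⇐ f [] h = refl
and-map⇐ f (x ∷ xs) h rewrite h x = and-map⇐ f xs h

or-map-false : (f : A → Bool) (xs : List A) → (∀ x → f x ≡ false) → or (map f xs) ≡ false
or-map-false f [] h = refl
or-map-false f (x ∷ xs) h rewrite h x = or-map-false f xs h

and-allFin⇒ : ∀ {K} (f : Fin K → Bool) → and (map f (allFin K)) ≡ true → ∀ i → f i ≡ true
and-allFin⇒ f e i = and-map⇒ f _ e (∈-allFin i)

ΣL : List A → (A → ℕ) → ℕ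
ΣL [] f = 0
ΣL (x ∷ xs) f = f x + ΣL xs f

ΣL-cong : (xs : List A) {f g : A → ℕ} → (∀ x → f x ≡ g x) → ΣL xs f ≡ ΣL xs g
ΣL-cong [] e = refl
ΣL-cong (x ∷ xs) e = cong₂ _+_ (e x) (ΣL-cong xs e)

ΣL-0 : (xs : List A) {f : A → ℕ} → (∀ x → f x ≡ 0) → ΣL xs f ≡ 0
ΣL-0 [] e = refl
ΣL-0 (x ∷ xs) e rewrite e x = ΣL-0 xs e

ΣL-distrib-+ : (xs : List A) (f g : A → ℕ) → ΣL xs (λ x → f x + g x) ≡ ΣL xs f + ΣL xs g
ΣL-distrib-+ [] f g = refl
ΣL-distrib-+ (x ∷ xs) f g rewrite ΣL-distrib-+ xs f g = +-interchange (f x) (g x) (ΣL xs f) (ΣL xs g)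

ΣL-distribˡ-* : (xs : List A) (a : ℕ) (f : A → ℕ) → ΣL xs (λ x → a * f x) ≡ a * ΣL xs f
ΣL-distribˡ-* [] a f = sym (ℕP.*-zeroʳ a)
ΣL-distribˡ-* (x ∷ xs) a f rewrite ΣL-distribˡ-* xs a f = sym (ℕP.*-distribˡ-+ a (f x) (ΣL xs f))

ΣL-const : (xs : List A) (a : ℕ) → ΣL xs (λ _ → a) ≡ length xs * a
ΣL-const [] a = refl
ΣL-const (x ∷ xs) a = cong (a +_) (ΣL-const xs a)

length≡ΣL-1 : (xs : List A) → length xs ≡ ΣL xs (λ _ → 1)
length≡ΣL-1 xs = sym (trans (ΣL-const xs 1) (ℕP.*-identityʳ (length xs)))

ΣL-mono-∈ : (xs : List A) {f g : A → ℕ} → (∀ {x} → x ∈ xs → f x ≤ g x) → ΣL xs f ≤ ΣL xs g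
ΣL-mono-∈ [] h = z≤n
ΣL-mono-∈ (x ∷ xs) h = ℕP.+-mono-≤ (h (here refl)) (ΣL-mono-∈ xs (λ x∈ → h (there x∈)))

ΣL-filterᵇ : (p : A → Bool) (xs : List A) (f : A → ℕ) →
  ΣL (filterᵇ p xs) f ≡ ΣL xs (λ x → if p x then f x else 0)
ΣL-filterᵇ p [] f = refl
ΣL-filterᵇ p (x ∷ xs) f with p x
... | true = cong (f x +_) (ΣL-filterᵇ p xs f)
... | false = ΣL-filterᵇ p xs f

ΣL-filterᵇ-𝟙 : (p : A → Bool) (xs : List A) (b : A → Bool) →
  ΣL (filterᵇ p xs) (λ x → 𝟙 (b x)) ≡ ΣL xs (λ x → 𝟙 (p x ∧ b x))
ΣL-filterᵇ-𝟙 p xs b = trans (ΣL-filterᵇ p xs _) (ΣL-cong xs if⇒∧)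
  where
  if⇒∧ : ∀ x → (if p x then 𝟙 (b x) else 0) ≡ 𝟙 (p x ∧ b x)
  if⇒∧ x with p x
  ... | true = refl
  ... | false = refl

length-filterᵇ : (p : A → Bool) (xs : List A) → length (filterᵇ p xs) ≡ ΣL xs (λ x → 𝟙 (p x))
length-filterᵇ p xs = trans (length≡ΣL-1 (filterᵇ p xs))
  (trans (ΣL-filterᵇ-𝟙 p xs (λ _ → true)) (ΣL-cong xs (λ x → cong 𝟙 (∧-identityʳ (p x)))))

ΣL-pairs : (xs : List A) (a b : A → B) (f : B → ℕ) →
  ΣL (concatMap (λ s → a s ∷ b s ∷ []) xs) f ≡ ΣL xs (λ s → f (a s)) + ΣL xs (λ s → f (b s))
ΣL-pairs [] a b f = refl
ΣL-pairs (x ∷ xs) a b f rewrite ΣL-pairs xs a b f =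
  trans (sym (ℕP.+-assoc (f (a x)) _ _)) (+-interchange (f (a x)) (f (b x)) _ _)

ΣL-comm : (xs : List A) (ys : List B) (g : A → B → ℕ) →
  ΣL xs (λ x → ΣL ys (g x)) ≡ ΣL ys (λ y → ΣL xs (λ x → g x y))
ΣL-comm [] ys g = sym (ΣL-0 ys (λ _ → refl))
ΣL-comm (x ∷ xs) ys g rewrite ΣL-comm xs ys g = sym (ΣL-distrib-+ ys (g x) (λ y → ΣL xs (λ x → g x y)))

ΣL-∑-comm : (xs : List A) (N : ℕ) (g : A → Fin N → ℕ) →
  ΣL xs (λ x → ∑[ v < N ] g x v) ≡ ∑[ v < N ] ΣL xs (λ x → g x v)
ΣL-∑-comm [] N g = sym (∑-0 {N} {λ _ → 0} (λ _ → refl))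
ΣL-∑-comm (x ∷ xs) N g = trans (cong (∑[ v < N ] g x v +_) (ΣL-∑-comm xs N g)) (sym (∑-distrib-+ (g x) _))

∈-filterᵇ⁻ : (p : A → Bool) (xs : List A) {x : A} → x ∈ filterᵇ p xs → p x ≡ true × x ∈ xs
∈-filterᵇ⁻ p (y ∷ ys) x∈ with p y in py
∈-filterᵇ⁻ p (y ∷ ys) (here refl) | true = py , here refl
∈-filterᵇ⁻ p (y ∷ ys) (there x∈) | true = Product.map₂ there (∈-filterᵇ⁻ p ys x∈)
∈-filterᵇ⁻ p (y ∷ ys) x∈ | false = Product.map₂ there (∈-filterᵇ⁻ p ys x∈)

∈-filterᵇ⁺ : (p : A → Bool) (xs : List A) {x : A} → x ∈ xs → p x ≡ true → x ∈ filterᵇ p xs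
∈-filterᵇ⁺ p (y ∷ ys) (here refl) px rewrite px = here refl
∈-filterᵇ⁺ p (y ∷ ys) (there x∈) px with p y
... | true = there (∈-filterᵇ⁺ p ys x∈ px)
... | false = ∈-filterᵇ⁺ p ys x∈ px

filterᵇ-cong-∈ : (xs : List A) {p q : A → Bool} → (∀ {x} → x ∈ xs → p x ≡ q x) → filterᵇ p xs ≡ filterᵇ q xs
filterᵇ-cong-∈ [] e = refl
filterᵇ-cong-∈ (x ∷ xs) {p} {q} e rewrite e (here refl) with q x
... | true = cong (x ∷_) (filterᵇ-cong-∈ xs (λ x∈ → e (there x∈)))
... | false = filterᵇ-cong-∈ xs (λ x∈ → e (there x∈))

∈-pair : {B : Set} (a b : A → B) {xs : List A} {x : A} {y : B} → x ∈ xs → y ∈ a x ∷ b x ∷ [] →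
  y ∈ concatMap (λ s → a s ∷ b s ∷ []) xs
∈-pair a b x∈ y∈ = ∈-concatMap⁺ (λ s → a s ∷ b s ∷ []) (lose x∈ y∈)

∈⇒length>0 : {xs : List A} {x : A} → x ∈ xs → 0 < length xs
∈⇒length>0 (here _) = s≤s z≤n
∈⇒length>0 (there _) = s≤s z≤n

∣∷∣ : ∀ {N} x (p : Subset N) → ∣ x ∷ p ∣ ≡ 𝟙 x + ∣ p ∣
∣∷∣ true p = refl
∣∷∣ false p = refl

∣∣≡∑ : ∀ {N} (σ : Subset N) → ∣ σ ∣ ≡ ∑[ v < N ] 𝟙 (lookup σ v)
∣∣≡∑ [] = refl
∣∣≡∑ (x ∷ σ) = trans (∣∷∣ x σ) (cong (𝟙 x +_) (∣∣≡∑ σ))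

⊆ᵇ-refl : ∀ {N} (σ : Subset N) → σ ⊆ᵇ σ ≡ true
⊆ᵇ-refl [] = refl
⊆ᵇ-refl (true ∷ σ) = ⊆ᵇ-refl σ
⊆ᵇ-refl (false ∷ σ) = ⊆ᵇ-refl σ

⊥⊆ᵇ : ∀ {N} (τ : Subset N) → ⊥ ⊆ᵇ τ ≡ true
⊥⊆ᵇ [] = refl
⊥⊆ᵇ (t ∷ τ) = ⊥⊆ᵇ τ

⊆ᵇ-∩-mono : ∀ {N} (σ τ B : Subset N) → σ ⊆ᵇ τ ≡ true → ∣ σ ∩ B ∣ ≤ ∣ τ ∩ B ∣
⊆ᵇ-∩-mono [] [] [] e = z≤n
⊆ᵇ-∩-mono (x ∷ σ) (y ∷ τ) (b ∷ B) e rewrite ∣∷∣ (x ∧ b) (σ ∩ B) | ∣∷∣ (y ∧ b) (τ ∩ B) =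
  ℕP.+-mono-≤ (head-mono x y b (∧-conicalˡ _ _ e)) (⊆ᵇ-∩-mono σ τ B (∧-conicalʳ _ _ e))
  where
  head-mono : ∀ x y b → (not x ∨ y) ≡ true → 𝟙 (x ∧ b) ≤ 𝟙 (y ∧ b)
  head-mono true true b _ = ℕP.≤-refl
  head-mono false y b _ = z≤n

⊆ᵇ⇒∣∣≤ : ∀ {N} (σ τ : Subset N) → σ ⊆ᵇ τ ≡ true → ∣ σ ∣ ≤ ∣ τ ∣
⊆ᵇ⇒∣∣≤ σ τ e = subst₂ _≤_ (cong ∣_∣ (∩-identityʳ σ)) (cong ∣_∣ (∩-identityʳ τ)) (⊆ᵇ-∩-mono σ τ ⊤ e)

⊆ᵇ-insert : ∀ {N} (σ : Subset N) v → σ ⊆ᵇ (σ [ v ]≔ true) ≡ true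
⊆ᵇ-insert (true ∷ σ) fz = ⊆ᵇ-refl σ
⊆ᵇ-insert (false ∷ σ) fz = ⊆ᵇ-refl σ
⊆ᵇ-insert (true ∷ σ) (fs v) = ⊆ᵇ-insert σ v
⊆ᵇ-insert (false ∷ σ) (fs v) = ⊆ᵇ-insert σ v

insert-⊆ᵇ : ∀ {N} (σ τ : Subset N) v → (σ [ v ]≔ true) ⊆ᵇ τ ≡ σ ⊆ᵇ τ ∧ lookup τ v
insert-⊆ᵇ (x ∷ σ) (t ∷ τ) fz = head x t (σ ⊆ᵇ τ)
  where
  head : ∀ x t s → t ∧ s ≡ ((not x ∨ t) ∧ s) ∧ t
  head true true s = sym (∧-identityʳ s)
  head true false s = refl
  head false true s = sym (∧-identityʳ s)
  head false false s = sym (∧-zeroʳ s)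
insert-⊆ᵇ (x ∷ σ) (t ∷ τ) (fs v) rewrite insert-⊆ᵇ σ τ v = sym (∧-assoc (not x ∨ t) _ _)

∣insert∣ : ∀ {N} (σ : Subset N) v → lookup σ v ≡ false → ∣ σ [ v ]≔ true ∣ ≡ suc ∣ σ ∣
∣insert∣ (false ∷ σ) fz e = refl
∣insert∣ (x ∷ σ) (fs v) e rewrite ∣∷∣ x (σ [ v ]≔ true) | ∣∷∣ x σ | ∣insert∣ σ v e = ℕP.+-suc (𝟙 x) ∣ σ ∣

∣insert∩∣ : ∀ {N} (σ B : Subset N) v → lookup σ v ≡ false →
  ∣ (σ [ v ]≔ true) ∩ B ∣ ≡ ∣ σ ∩ B ∣ + 𝟙 (lookup B v)
∣insert∩∣ (false ∷ σ) (b ∷ B) fz e = trans (∣∷∣ b (σ ∩ B)) (ℕP.+-comm (𝟙 b) ∣ σ ∩ B ∣)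
∣insert∩∣ (x ∷ σ) (b ∷ B) (fs v) e
  rewrite ∣∷∣ (x ∧ b) ((σ [ v ]≔ true) ∩ B) | ∣∷∣ (x ∧ b) (σ ∩ B) | ∣insert∩∣ σ B v e =
  sym (ℕP.+-assoc (𝟙 (x ∧ b)) ∣ σ ∩ B ∣ (𝟙 (lookup B v)))

∣remove∩∣ : ∀ {N} (τ B : Subset N) u → lookup τ u ≡ true →
  ∣ τ ∩ B ∣ ≡ ∣ (τ [ u ]≔ false) ∩ B ∣ + 𝟙 (lookup B u)
∣remove∩∣ (true ∷ τ) (b ∷ B) fz e = trans (∣∷∣ b (τ ∩ B)) (ℕP.+-comm (𝟙 b) ∣ τ ∩ B ∣)
∣remove∩∣ (x ∷ τ) (b ∷ B) (fs u) e
  rewrite ∣∷∣ (x ∧ b) ((τ [ u ]≔ false) ∩ B) | ∣∷∣ (x ∧ b) (τ ∩ B) | ∣remove∩∣ τ B u e =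
  sym (ℕP.+-assoc (𝟙 (x ∧ b)) ∣ (τ [ u ]≔ false) ∩ B ∣ (𝟙 (lookup B u)))

∣∣-difference : ∀ {N} (ρ τ : Subset N) → ρ ⊆ᵇ τ ≡ true →
  ∑[ v < N ] 𝟙 (not (lookup ρ v) ∧ lookup τ v) + ∣ ρ ∣ ≡ ∣ τ ∣
∣∣-difference [] [] e = refl
∣∣-difference (true ∷ ρ) (true ∷ τ) e = trans (ℕP.+-suc _ ∣ ρ ∣) (cong suc (∣∣-difference ρ τ e))
∣∣-difference (false ∷ ρ) (true ∷ τ) e = cong suc (∣∣-difference ρ τ e)
∣∣-difference (false ∷ ρ) (false ∷ τ) e = ∣∣-difference ρ τ e

ΣS : ∀ N → (Subset N → ℕ) → ℕ
ΣS N f = ΣL (allSubsets N) f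

ΣS-suc : ∀ N (f : Subset (suc N) → ℕ) →
  ΣS (suc N) f ≡ ΣS N (λ s → f (false ∷ s)) + ΣS N (λ s → f (true ∷ s))
ΣS-suc N f = ΣL-pairs (allSubsets N) (false ∷_) (true ∷_) f

∈-allSubsets : ∀ {N} (s : Subset N) → s ∈ allSubsets N
∈-allSubsets [] = here refl
∈-allSubsets (false ∷ s) = ∈-pair (false ∷_) (true ∷_) (∈-allSubsets s) (here refl)
∈-allSubsets (true ∷ s) = ∈-pair (false ∷_) (true ∷_) (∈-allSubsets s) (there (here refl))

ΣS-⊇-same-size : ∀ N (σ : Subset N) (R : Subset N → Bool) →
  ΣS N (λ τ → 𝟙 (σ ⊆ᵇ τ ∧ ((∣ τ ∣ ≡ᵇ ∣ σ ∣) ∧ R τ))) ≡ 𝟙 (R σ)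
ΣS-⊇-same-size zero [] R with R []
... | true = refl
... | false = refl
ΣS-⊇-same-size (suc N) (true ∷ σ) R =
  trans (ΣS-suc N _) (cong₂ _+_ (ΣL-0 (allSubsets N) (λ _ → refl)) (ΣS-⊇-same-size N σ (λ s → R (true ∷ s))))
ΣS-⊇-same-size (suc N) (false ∷ σ) R =
  trans (ΣS-suc N _) (trans (cong₂ _+_ (ΣS-⊇-same-size N σ (λ s → R (false ∷ s))) (ΣL-0 (allSubsets N) too-big))
                            (ℕP.+-identityʳ _))
  where
  too-big : ∀ τ → 𝟙 (σ ⊆ᵇ τ ∧ ((suc ∣ τ ∣ ≡ᵇ ∣ σ ∣) ∧ R (true ∷ τ))) ≡ 0
  too-big τ with σ ⊆ᵇ τ in e
  ... | false = refl
  ... | true rewrite ≢⇒≡ᵇ-false (suc ∣ τ ∣) ∣ σ ∣ (ℕP.>⇒≢ (s≤s (⊆ᵇ⇒∣∣≤ σ τ e))) = refl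

ΣS-⊆-same-size : ∀ N (τ : Subset N) (P : Subset N → Bool) →
  ΣS N (λ σ → 𝟙 (σ ⊆ᵇ τ ∧ ((∣ σ ∣ ≡ᵇ ∣ τ ∣) ∧ P σ))) ≡ 𝟙 (P τ)
ΣS-⊆-same-size zero [] P with P []
... | true = refl
... | false = refl
ΣS-⊆-same-size (suc N) (false ∷ τ) P =
  trans (ΣS-suc N _) (trans (cong₂ _+_ (ΣS-⊆-same-size N τ (λ s → P (false ∷ s))) (ΣL-0 (allSubsets N) (λ _ → refl)))
                            (ℕP.+-identityʳ _))
ΣS-⊆-same-size (suc N) (true ∷ τ) P =
  trans (ΣS-suc N _) (cong₂ _+_ (ΣL-0 (allSubsets N) too-small) (ΣS-⊆-same-size N τ (λ s → P (true ∷ s))))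
  where
  too-small : ∀ σ → 𝟙 (σ ⊆ᵇ τ ∧ ((∣ σ ∣ ≡ᵇ suc ∣ τ ∣) ∧ P (false ∷ σ))) ≡ 0
  too-small σ with σ ⊆ᵇ τ in e
  ... | false = refl
  ... | true rewrite ≢⇒≡ᵇ-false ∣ σ ∣ (suc ∣ τ ∣) (ℕP.<⇒≢ (s≤s (⊆ᵇ⇒∣∣≤ σ τ e))) = refl

ΣS-⊇-one-more : ∀ N (σ : Subset N) (Q : Subset N → Bool) →
  ΣS N (λ τ → 𝟙 (σ ⊆ᵇ τ ∧ ((∣ τ ∣ ≡ᵇ suc ∣ σ ∣) ∧ Q τ))) ≡
  ∑[ v < N ] 𝟙 (not (lookup σ v) ∧ Q (σ [ v ]≔ true))
ΣS-⊇-one-more zero [] Q = refl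
ΣS-⊇-one-more (suc N) (true ∷ σ) Q =
  trans (ΣS-suc N _) (cong₂ _+_ (ΣL-0 (allSubsets N) (λ _ → refl)) (ΣS-⊇-one-more N σ (λ s → Q (true ∷ s))))
ΣS-⊇-one-more (suc N) (false ∷ σ) Q =
  trans (ΣS-suc N _)
    (trans (cong₂ _+_ (ΣS-⊇-one-more N σ (λ s → Q (false ∷ s))) (ΣS-⊇-same-size N σ (λ s → Q (true ∷ s))))
           (ℕP.+-comm _ (𝟙 (Q (true ∷ σ)))))

ΣS-⊆-one-less : ∀ N (τ : Subset N) (P : Subset N → Bool) →
  ΣS N (λ σ → 𝟙 (σ ⊆ᵇ τ ∧ ((suc ∣ σ ∣ ≡ᵇ ∣ τ ∣) ∧ P σ))) ≡
  ∑[ u < N ] 𝟙 (lookup τ u ∧ P (τ [ u ]≔ false))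
ΣS-⊆-one-less zero [] P = refl
ΣS-⊆-one-less (suc N) (false ∷ τ) P =
  trans (ΣS-suc N _)
    (trans (cong₂ _+_ (ΣS-⊆-one-less N τ (λ s → P (false ∷ s))) (ΣL-0 (allSubsets N) (λ _ → refl)))
           (ℕP.+-identityʳ _))
ΣS-⊆-one-less (suc N) (true ∷ τ) P =
  trans (ΣS-suc N _) (cong₂ _+_ (ΣS-⊆-same-size N τ (λ s → P (false ∷ s))) (ΣS-⊆-one-less N τ (λ s → P (true ∷ s))))

lookup-block : ∀ {N A} (g : Fin N → Fin (suc A)) a v → lookup (block g a) v ≡ does (g v FinP.≟ a)
lookup-block g a v = lookup∘tabulate _ v

blockCount : ∀ {N A} → Subset N → (Fin N → Fin (suc A)) → Fin (suc A) → ℕ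
blockCount σ g a = ∣ σ ∩ block g a ∣

blockCount≡∑ : ∀ {N A} (σ : Subset N) (g : Fin N → Fin (suc A)) a →
  blockCount σ g a ≡ ∑[ v < N ] 𝟙 (lookup σ v ∧ does (g v FinP.≟ a))
blockCount≡∑ σ g a = trans (∣∣≡∑ (σ ∩ block g a)) (sum-cong-≗ λ v →
  cong 𝟙 (trans (lookup-zipWith _∧_ v σ _) (cong (lookup σ v ∧_) (lookup-block g a v))))

∣∣≡∑-blockCount : ∀ {N A} (σ : Subset N) (g : Fin N → Fin (suc A)) → ∣ σ ∣ ≡ ∑[ a < suc A ] blockCount σ g a
∣∣≡∑-blockCount {N} {A} σ g = begin
  ∣ σ ∣                                                         ≡⟨ ∣∣≡∑ σ ⟩
  ∑[ v < N ] 𝟙 (lookup σ v)                                     ≡⟨ sum-cong-≗ (λ v → sym (split v)) ⟩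
  ∑[ v < N ] ∑[ a < suc A ] 𝟙 (lookup σ v ∧ does (g v FinP.≟ a))    ≡⟨ ∑-comm (λ v a → 𝟙 (lookup σ v ∧ does (g v FinP.≟ a))) ⟩
  ∑[ a < suc A ] ∑[ v < N ] 𝟙 (lookup σ v ∧ does (g v FinP.≟ a))    ≡⟨ sum-cong-≗ (λ a → sym (blockCount≡∑ σ g a)) ⟩
  ∑[ a < suc A ] blockCount σ g a                                   ∎
  where
  open ≡-Reasoning
  split : ∀ v → ∑[ a < suc A ] 𝟙 (lookup σ v ∧ does (g v FinP.≟ a)) ≡ 𝟙 (lookup σ v)
  split v = trans (sum-cong-≗ (λ a → 𝟙-∧ (lookup σ v) (does (g v FinP.≟ a)))) (∑-δ (g v) (λ _ → 𝟙 (lookup σ v)))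

blockCount-insert-own : ∀ {N A} (σ : Subset N) (g : Fin N → Fin (suc A)) v → lookup σ v ≡ false →
  blockCount (σ [ v ]≔ true) g (g v) ≡ suc (blockCount σ g (g v))
blockCount-insert-own σ g v v∉σ = trans (∣insert∩∣ σ (block g (g v)) v v∉σ)
  (trans (cong (λ b → blockCount σ g (g v) + 𝟙 b) (trans (lookup-block g (g v) v) (dec-true (g v FinP.≟ g v) refl)))
         (ℕP.+-comm _ 1))

missedBlocks+∣∣ : ∀ {N A} (σ : Subset N) (g : Fin N → Fin (suc A)) → (∀ a → blockCount σ g a ≤ 1) →
  ∑[ a < suc A ] 𝟙 (blockCount σ g a ≡ᵇ 0) + ∣ σ ∣ ≡ suc A
missedBlocks+∣∣ σ g ≤1 =
  trans (cong (∑[ a < _ ] 𝟙 (blockCount σ g a ≡ᵇ 0) +_) (∣∣≡∑-blockCount σ g)) (∑-zeros (blockCount σ g) ≤1)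

-- a /suc d = a / (d + 1), so that no NonZero instance has to be carried around.
_/suc_ : ℕ → ℕ → ℚ
a /suc d = ℤ.+ a ℚ./ suc d

toℚᵘ-/suc : ∀ a d → toℚᵘ (a /suc d) ℚᵘ.≃ mkℚᵘ (ℤ.+ a) d
toℚᵘ-/suc a d = ℚP.toℚᵘ-fromℚᵘ (mkℚᵘ (ℤ.+ a) d)

/suc-+ : ∀ a b d → a /suc d ℚ.+ b /suc d ≡ (a + b) /suc d
/suc-+ a b d = ℚP.toℚᵘ-injective (ℚᵘP.≃-trans (ℚP.toℚᵘ-homo-+ (a /suc d) (b /suc d))
  (ℚᵘP.≃-trans (ℚᵘP.+-cong (toℚᵘ-/suc a d) (toℚᵘ-/suc b d)) (ℚᵘP.≃-trans same-denominator (ℚᵘP.≃-sym (toℚᵘ-/suc (a + b) d)))))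
  where
  same-denominator : mkℚᵘ (ℤ.+ a) d ℚᵘ.+ mkℚᵘ (ℤ.+ b) d ℚᵘ.≃ mkℚᵘ (ℤ.+ (a + b)) d
  same-denominator = *≡* (trans (ring (ℤ.+ a) (ℤ.+ b) (ℤ.+ suc d))
    (cong₂ ℤ._*_ (sym (ℤP.pos-+ a b)) (sym (ℤP.pos-* (suc d) (suc d)))))
    where
    ring : ∀ x y z → (x ℤ.* z ℤ.+ y ℤ.* z) ℤ.* z ≡ (x ℤ.+ y) ℤ.* (z ℤ.* z)
    ring = ℤ-Solver.solve-∀

0≡0/suc : ∀ d → 0ℚ ≡ 0 /suc d
0≡0/suc d = ℚP.toℚᵘ-injective (ℚᵘP.≃-trans (toℚᵘ-/suc 0 0) (ℚᵘP.≃-trans (*≡* refl) (ℚᵘP.≃-sym (toℚᵘ-/suc 0 d))))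

/suc-mono-≤ : ∀ a b d₁ d₂ → a * suc d₂ ≤ b * suc d₁ → a /suc d₁ ℚ.≤ b /suc d₂
/suc-mono-≤ a b d₁ d₂ p = ℚP.toℚᵘ-cancel-≤
  (ℚᵘP.≤-respʳ-≃ (ℚᵘP.≃-sym (toℚᵘ-/suc b d₂)) (ℚᵘP.≤-respˡ-≃ (ℚᵘP.≃-sym (toℚᵘ-/suc a d₁))
    (*≤* (subst₂ ℤ._≤_ (ℤP.pos-* a (suc d₂)) (ℤP.pos-* b (suc d₁)) (ℤ.+≤+ p)))))

/suc-pos : ∀ a d → 1 ≤ a → 0ℚ ℚ.< a /suc d
/suc-pos (suc a) d _ = ℚP.positive⁻¹ (suc a /suc d) {{ℚP.normalize-pos (suc a) (suc d)}}

sumℚ-const : (xs : List A) (f : A → ℚ) (a d : ℕ) → (∀ {x} → x ∈ xs → f x ≡ a /suc d) →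
  sumℚ (map f xs) ≡ (length xs * a) /suc d
sumℚ-const [] f a d e = 0≡0/suc d
sumℚ-const (x ∷ xs) f a d e =
  trans (cong₂ ℚ._+_ (e (here refl)) (sumℚ-const xs f a d (λ x∈ → e (there x∈)))) (/suc-+ a _ d)

pos⇒1/nonNeg : ∀ p .{{_ : NonZero p}} → Positive p → NonNegative (ℚ.1/ p)
pos⇒1/nonNeg (mkℚ ℤ.+[1+ n ] d c) _ = _

divℚ≤1 : ∀ p q → p ℚ.≤ q → 0ℚ ℚ.< p → divℚ p q ℚ.≤ 1ℚ
divℚ≤1 p q p≤q 0<p with q ℚP.≟ 0ℚ
... | yes q≡0 = contradiction (subst (0ℚ ℚ.<_) q≡0 (ℚP.<-≤-trans 0<p p≤q)) (ℚP.<-irrefl refl)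
... | no q≢0 = ℚP.≤-trans (ℚP.*-monoʳ-≤-nonNeg (ℚ.1/ q) {{1/q≥0}} p≤q) (ℚP.≤-reflexive (ℚP.*-inverseʳ q))
  where
  instance
    q≢0′ : NonZero q
    q≢0′ = ≢-nonZero q≢0
    q>0 : Positive q
    q>0 = positive (ℚP.<-≤-trans 0<p p≤q)
  1/q≥0 : NonNegative (ℚ.1/ q)
  1/q≥0 = pos⇒1/nonNeg q q>0

foldr-⊓-glb : (xs : List A) (f : A → ℚ) {p q : ℚ} → p ℚ.≤ q → (∀ x → p ℚ.≤ f x) →
  p ℚ.≤ foldr ℚ._⊓_ q (map f xs)
foldr-⊓-glb [] f p≤q h = p≤q
foldr-⊓-glb (x ∷ xs) f p≤q h = ℚP.⊓-glb (h x) (foldr-⊓-glb xs f p≤q h)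

foldr-⊓∞-≤ : (f : A → ℚ∞) (xs : List A) {x : A} {c : ℚ} → x ∈ xs → f x ≤∞ fin c →
  foldr _⊓∞_ ∞ (map f xs) ≤∞ fin c
foldr-⊓∞-≤ f (y ∷ ys) (here refl) le with f y | le | foldr _⊓∞_ ∞ (map f ys)
... | fin a | fin≤fin p | fin b = fin≤fin (ℚP.≤-trans (ℚP.p⊓q≤p a b) p)
... | fin a | fin≤fin p | ∞ = fin≤fin p
foldr-⊓∞-≤ f (y ∷ ys) (there x∈) le with f y | foldr _⊓∞_ ∞ (map f ys) | foldr-⊓∞-≤ f ys x∈ le
... | fin a | fin b | fin≤fin p = fin≤fin (ℚP.≤-trans (ℚP.p⊓q≤q a b) p)
... | ∞ | fin b | fin≤fin p = fin≤fin p

1≤nCk : ∀ n k → k ≤ n → 1 ≤ n C k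
1≤nCk n zero _ = ℕP.≤-refl
1≤nCk (suc n) (suc k) (s≤s k≤n) =
  subst (1 ≤_) (nCk+nC[k+1]≡[n+1]C[k+1] n k) (ℕP.≤-trans (1≤nCk n k k≤n) (ℕP.m≤m+n _ _))

nC[k+1]*[k+1]≡nCk*[n∸k] : ∀ n k → (n C suc k) * suc k ≡ (n C k) * (n ∸ k)
nC[k+1]*[k+1]≡nCk*[n∸k] zero k = sym (trans (cong ((0 C k) *_) (ℕP.0∸n≡0 k)) (ℕP.*-zeroʳ (0 C k)))
nC[k+1]*[k+1]≡nCk*[n∸k] (suc n) zero =
  trans (ℕP.*-identityʳ _) (trans (nC1≡n (suc n)) (sym (ℕP.+-identityʳ (suc n))))
nC[k+1]*[k+1]≡nCk*[n∸k] (suc n) (suc k) = begin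
  (suc n C suc (suc k)) * suc (suc k)
    ≡⟨ cong (_* suc (suc k)) (sym (nCk+nC[k+1]≡[n+1]C[k+1] n (suc k))) ⟩
  (a + b) * suc (suc k)
    ≡⟨ ℕP.*-distribʳ-+ (suc (suc k)) a b ⟩
  a * suc (suc k) + b * suc (suc k)
    ≡⟨ cong (a * suc (suc k) +_) (nC[k+1]*[k+1]≡nCk*[n∸k] n (suc k)) ⟩
  a * suc (suc k) + a * (n ∸ suc k)
    ≡⟨ sym (ℕP.*-distribˡ-+ a (suc (suc k)) (n ∸ suc k)) ⟩
  a * (suc (suc k) + (n ∸ suc k))
    ≡⟨ shift ⟩
  a * (suc k + (n ∸ k))
    ≡⟨ ℕP.*-distribˡ-+ a (suc k) (n ∸ k) ⟩
  a * suc k + a * (n ∸ k)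
    ≡⟨ cong (_+ a * (n ∸ k)) (nC[k+1]*[k+1]≡nCk*[n∸k] n k) ⟩
  (n C k) * (n ∸ k) + a * (n ∸ k)
    ≡⟨ sym (ℕP.*-distribʳ-+ (n ∸ k) (n C k) a) ⟩
  ((n C k) + a) * (n ∸ k)
    ≡⟨ cong (_* (n ∸ k)) (nCk+nC[k+1]≡[n+1]C[k+1] n k) ⟩
  (suc n C suc k) * (suc n ∸ suc k) ∎
  where
  open ≡-Reasoning
  a = n C suc k
  b = n C suc (suc k)
  -- For n ≤ k truncated subtraction makes the two factors differ, but then a = 0.
  shift : a * (suc (suc k) + (n ∸ suc k)) ≡ a * (suc k + (n ∸ k))
  shift with k ℕ.<? n
  ... | yes k<n = cong (a *_) (sym (trans (cong (suc k +_) (ℕP.+-∸-assoc 1 k<n)) (ℕP.+-suc (suc k) (n ∸ suc k))))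
  ... | no k≮n rewrite k>n⇒nCk≡0 {n} {suc k} (s≤s (ℕP.≮⇒≥ k≮n)) = refl

divℕ≡/suc : ∀ a D → 1 ≤ D → divℕ a D ≡ a /suc ℕ.pred D
divℕ≡/suc a (suc D) _ = refl

xorSum : List A → (A → Bool) → Bool
xorSum xs f = foldr (λ x b → f x xor b) false xs

xorSum-cong-∈ : (xs : List A) {f g : A → Bool} → (∀ {x} → x ∈ xs → f x ≡ g x) → xorSum xs f ≡ xorSum xs g
xorSum-cong-∈ [] e = refl
xorSum-cong-∈ (x ∷ xs) e = cong₂ _xor_ (e (here refl)) (xorSum-cong-∈ xs (λ x∈ → e (there x∈)))

xorSum-distrib-xor : (xs : List A) (f g s : A → Bool) →
  xorSum xs (λ x → (f x xor g x) ∧ s x) ≡ xorSum xs (λ x → f x ∧ s x) xor xorSum xs (λ x → g x ∧ s x)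
xorSum-distrib-xor [] f g s = refl
xorSum-distrib-xor (x ∷ xs) f g s rewrite xorSum-distrib-xor xs f g s = distrib (f x) (g x) (s x) _ _
  where
  open xor-∧-Solver
  distrib : ∀ a b c u v → ((a xor b) ∧ c) xor (u xor v) ≡ ((a ∧ c) xor u) xor ((b ∧ c) xor v)
  distrib = solve 5 (λ a b c u v → ((a :+ b) :* c) :+ (u :+ v) := ((a :* c) :+ u) :+ ((b :* c) :+ v)) refl

parity-ΣL : (xs : List A) (g : A → ℕ) → parity (ΣL xs g) ≡ xorSum xs (λ x → parity (g x))
parity-ΣL [] g = refl
parity-ΣL (x ∷ xs) g rewrite parity-+ (g x) (ΣL xs g) | parity-ΣL xs g = refl

xorSum≡parity : (xs : List A) (f : A → Bool) → xorSum xs f ≡ parity (ΣL xs (λ x → 𝟙 (f x)))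
xorSum≡parity xs f = trans (xorSum-cong-∈ xs (λ {x} _ → sym (parity-𝟙 (f x)))) (sym (parity-ΣL xs (λ x → 𝟙 (f x))))

parity-ΣL-even-∈ : (xs : List A) (g : A → ℕ) → (∀ {x} → x ∈ xs → parity (g x) ≡ false) → parity (ΣL xs g) ≡ false
parity-ΣL-even-∈ [] g e = refl
parity-ΣL-even-∈ (x ∷ xs) g e rewrite parity-+ (g x) (ΣL xs g) | e (here refl) | parity-ΣL-even-∈ xs g (λ x∈ → e (there x∈)) = refl

parity-ΣL-𝟙-parity : (xs : List A) (g : A → ℕ) (b : A → Bool) →
  parity (ΣL xs (λ x → 𝟙 (parity (g x) ∧ b x))) ≡ parity (ΣL xs (λ x → 𝟙 (b x) * g x))
parity-ΣL-𝟙-parity xs g b = begin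
  parity (ΣL xs (λ x → 𝟙 (parity (g x) ∧ b x)))        ≡⟨ parity-ΣL xs _ ⟩
  xorSum xs (λ x → parity (𝟙 (parity (g x) ∧ b x)))    ≡⟨ xorSum-cong-∈ xs (λ {x} _ → pointwise x) ⟩
  xorSum xs (λ x → parity (𝟙 (b x) * g x))             ≡⟨ sym (parity-ΣL xs _) ⟩
  parity (ΣL xs (λ x → 𝟙 (b x) * g x))                 ∎
  where
  open ≡-Reasoning
  pointwise : ∀ x → parity (𝟙 (parity (g x) ∧ b x)) ≡ parity (𝟙 (b x) * g x)
  pointwise x = trans (parity-𝟙 _) (trans (∧-comm (parity (g x)) (b x)) (sym (parity-𝟙* (b x) (g x))))

DownClosed : Complex → Set
DownClosed X = ∀ σ τ → σ ⊆ᵇ τ ≡ true → member X τ ≡ true → member X σ ≡ true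

module _ (X : Complex) where

  ΣL-faces-above : ∀ s (σ : Subset (N X)) (R : Subset (N X) → Bool) →
    ΣL (faces X s) (λ τ → 𝟙 (R τ ∧ σ ⊆ᵇ τ)) ≡
    ΣS (N X) (λ τ → 𝟙 (σ ⊆ᵇ τ ∧ ((∣ τ ∣ ≡ᵇ s) ∧ (member X τ ∧ R τ))))
  ΣL-faces-above s σ R = trans (ΣL-filterᵇ _ (allSubsets (N X)) _) (ΣL-cong (allSubsets (N X)) reshape)
    where
    reshape : ∀ τ → (if member X τ ∧ (∣ τ ∣ ≡ᵇ s) then 𝟙 (R τ ∧ σ ⊆ᵇ τ) else 0) ≡
                    𝟙 (σ ⊆ᵇ τ ∧ ((∣ τ ∣ ≡ᵇ s) ∧ (member X τ ∧ R τ)))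
    reshape τ with member X τ | ∣ τ ∣ ≡ᵇ s
    ... | true | true = cong 𝟙 (∧-comm (R τ) (σ ⊆ᵇ τ))
    ... | true | false = cong 𝟙 (sym (∧-zeroʳ (σ ⊆ᵇ τ)))
    ... | false | true = cong 𝟙 (sym (∧-zeroʳ (σ ⊆ᵇ τ)))
    ... | false | false = cong 𝟙 (sym (∧-zeroʳ (σ ⊆ᵇ τ)))

  ∈-faces⁻ : ∀ {s σ} → σ ∈ faces X s → member X σ ≡ true × ∣ σ ∣ ≡ s
  ∈-faces⁻ {s} {σ} σ∈ = ∧-conicalˡ _ _ e , ≡ᵇ-true⇒≡ _ _ (∧-conicalʳ (member X σ) _ e)
    where e = proj₁ (∈-filterᵇ⁻ _ (allSubsets (N X)) σ∈)

  ∈-faces⁺ : ∀ {s σ} → member X σ ≡ true → ∣ σ ∣ ≡ s → σ ∈ faces X s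
  ∈-faces⁺ {s} {σ} mσ ∣σ∣≡s =
    ∈-filterᵇ⁺ _ (allSubsets (N X)) (∈-allSubsets σ) (cong₂ _∧_ mσ (≡⇒≡ᵇ-true _ _ ∣σ∣≡s))

  cobd-⊕ : ∀ j (f g : Cochain X) τ → cobd X j (_⊕_ {X} f g) τ ≡ cobd X j f τ xor cobd X j g τ
  cobd-⊕ j f g τ = xorSum-distrib-xor (faces X j) f g (_⊆ᵇ τ)

  cobd-cong-∈ : ∀ j {f g : Cochain X} → (∀ {σ} → σ ∈ faces X j → f σ ≡ g σ) → ∀ τ → cobd X j f τ ≡ cobd X j g τ
  cobd-cong-∈ j e τ = xorSum-cong-∈ (faces X j) (λ {σ} σ∈ → cong (_∧ σ ⊆ᵇ τ) (e σ∈))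

  -- h only ranges over the cochains enumerated by allCochains, so every cochain must first be
  -- replaced by the enumerated one agreeing with it on the relevant faces.
  enumerated-representative : (σs : List (Subset (N X))) (φ : Cochain X) →
    Σ (Cochain X) λ φ₀ → φ₀ ∈ allCochains X σs × (∀ {σ} → σ ∈ σs → φ₀ σ ≡ φ σ)
  enumerated-representative σs φ = Product.map₂ (Product.map₂ proj₁) (supported σs)
    where
    ==ˢ⇒≡ : ∀ {σ τ} → (σ ==ˢ τ) ≡ true → σ ≡ τ
    ==ˢ⇒≡ {σ} {τ} = does-true⇒ (VecP.≡-dec BoolP._≟_ σ τ)
    ==ˢ-refl : ∀ σ → (σ ==ˢ σ) ≡ true
    ==ˢ-refl σ = dec-true (VecP.≡-dec BoolP._≟_ σ σ) refl
    supported : (σs : List (Subset (N X))) → Σ (Cochain X) λ φ₀ → φ₀ ∈ allCochains X σs ×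
      ((∀ {σ} → σ ∈ σs → φ₀ σ ≡ φ σ) × (∀ σ → φ₀ σ ≡ true → σ ∈ σs))
    supported [] = (λ _ → false) , here refl , (λ ()) , (λ σ ())
    supported (f ∷ σs) with supported σs | φ f in φf
    ... | g , g∈ , agree , supp | true =
      g′ , ∈-pair (λ g → g) (λ g σ → if σ ==ˢ f then true else g σ) g∈ (there (here refl)) , agree′ , supp′
      where
      g′ : Cochain X
      g′ σ = if σ ==ˢ f then true else g σ
      agree′ : ∀ {σ} → σ ∈ f ∷ σs → g′ σ ≡ φ σ
      agree′ {σ} σ∈ with σ ==ˢ f in e
      agree′ σ∈ | true = sym (trans (cong φ (==ˢ⇒≡ e)) φf)
      agree′ {σ} (here refl) | false = contradiction (trans (sym e) (==ˢ-refl σ)) (λ ())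
      agree′ (there σ∈) | false = agree σ∈
      supp′ : ∀ σ → g′ σ ≡ true → σ ∈ f ∷ σs
      supp′ σ t with σ ==ˢ f in e
      ... | true = here (==ˢ⇒≡ e)
      ... | false = there (supp σ t)
    ... | g , g∈ , agree , supp | false =
      g , ∈-pair (λ g → g) (λ g σ → if σ ==ˢ f then true else g σ) g∈ (here refl) , agree′ , (λ σ t → there (supp σ t))
      where
      agree′ : ∀ {σ} → σ ∈ f ∷ σs → g σ ≡ φ σ
      agree′ {σ} (here refl) with g σ in gσ
      ... | false = sym φf
      ... | true = contradiction (trans (sym φf) (trans (sym (agree (supp σ gσ))) gσ)) (λ ())
      agree′ (there σ∈) = agree σ∈

  module _ (down : DownClosed X) where

    ΣL-faces-below : ∀ s {τ} → member X τ ≡ true → (P : Subset (N X) → Bool) →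
      ΣL (faces X s) (λ σ → 𝟙 (P σ ∧ σ ⊆ᵇ τ)) ≡ ΣS (N X) (λ σ → 𝟙 (σ ⊆ᵇ τ ∧ ((∣ σ ∣ ≡ᵇ s) ∧ P σ)))
    ΣL-faces-below s {τ} mτ P = trans (ΣL-filterᵇ _ (allSubsets (N X)) _) (ΣL-cong (allSubsets (N X)) reshape)
      where
      reshape : ∀ σ → (if member X σ ∧ (∣ σ ∣ ≡ᵇ s) then 𝟙 (P σ ∧ σ ⊆ᵇ τ) else 0) ≡
                      𝟙 (σ ⊆ᵇ τ ∧ ((∣ σ ∣ ≡ᵇ s) ∧ P σ))
      reshape σ with σ ⊆ᵇ τ in σ⊆τ
      reshape σ | false with member X σ ∧ (∣ σ ∣ ≡ᵇ s)
      ... | true = cong 𝟙 (∧-zeroʳ (P σ))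
      ... | false = refl
      reshape σ | true rewrite down σ τ σ⊆τ mτ with ∣ σ ∣ ≡ᵇ s
      ... | true = cong 𝟙 (∧-identityʳ (P σ))
      ... | false = refl

    -- A face ρ ⊆ τ with two more elements lies in exactly two faces between them.
    parity-faces-between : ∀ k {ρ τ} → ∣ ρ ∣ ≡ k → member X τ ≡ true → ∣ τ ∣ ≡ suc (suc k) →
      parity (ΣL (faces X (suc k)) (λ σ → 𝟙 (ρ ⊆ᵇ σ ∧ σ ⊆ᵇ τ))) ≡ false
    parity-faces-between k {ρ} {τ} refl mτ ∣τ∣≡ = begin
      parity (ΣL (faces X (suc k)) (λ σ → 𝟙 (ρ ⊆ᵇ σ ∧ σ ⊆ᵇ τ)))
        ≡⟨ cong parity (ΣL-faces-below (suc k) mτ (ρ ⊆ᵇ_)) ⟩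
      parity (ΣS (N X) (λ σ → 𝟙 (σ ⊆ᵇ τ ∧ ((∣ σ ∣ ≡ᵇ suc k) ∧ ρ ⊆ᵇ σ))))
        ≡⟨ cong parity (ΣL-cong (allSubsets (N X)) (λ σ → cong 𝟙 (rotate (σ ⊆ᵇ τ) _ (ρ ⊆ᵇ σ)))) ⟩
      parity (ΣS (N X) (λ σ → 𝟙 (ρ ⊆ᵇ σ ∧ ((∣ σ ∣ ≡ᵇ suc k) ∧ σ ⊆ᵇ τ))))
        ≡⟨ cong parity (ΣS-⊇-one-more (N X) ρ (_⊆ᵇ τ)) ⟩
      parity (∑[ v < N X ] 𝟙 (not (lookup ρ v) ∧ (ρ [ v ]≔ true) ⊆ᵇ τ))
        ≡⟨ cong parity (sum-cong-≗ (λ v → cong (λ b → 𝟙 (not (lookup ρ v) ∧ b)) (insert-⊆ᵇ ρ τ v))) ⟩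
      parity (∑[ v < N X ] 𝟙 (not (lookup ρ v) ∧ (ρ ⊆ᵇ τ ∧ lookup τ v)))
        ≡⟨ even ⟩
      false ∎
      where
      open ≡-Reasoning
      rotate : ∀ a b c → a ∧ (b ∧ c) ≡ c ∧ (b ∧ a)
      rotate = solve 3 (λ a b c → a :* (b :* c) := c :* (b :* a)) refl
        where open ∨-∧-Solver
      even : parity (∑[ v < N X ] 𝟙 (not (lookup ρ v) ∧ (ρ ⊆ᵇ τ ∧ lookup τ v))) ≡ false
      even with ρ ⊆ᵇ τ in ρ⊆τ
      ... | false = cong parity (∑-0 (λ v → cong 𝟙 (∧-zeroʳ (not (lookup ρ v)))))
      ... | true = cong parity (ℕP.+-cancelʳ-≡ ∣ ρ ∣ _ 2 (trans (∣∣-difference ρ τ ρ⊆τ) ∣τ∣≡))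

    cobd∘cobd≡false : ∀ k ψ {τ} → member X τ ≡ true → ∣ τ ∣ ≡ suc (suc k) → cobd X (suc k) (cobd X k ψ) τ ≡ false
    cobd∘cobd≡false k ψ {τ} mτ ∣τ∣≡ = begin
      cobd X (suc k) (cobd X k ψ) τ
        ≡⟨ xorSum≡parity F₁ (λ σ → cobd X k ψ σ ∧ σ ⊆ᵇ τ) ⟩
      parity (ΣL F₁ (λ σ → 𝟙 (cobd X k ψ σ ∧ σ ⊆ᵇ τ)))
        ≡⟨ cong parity (ΣL-cong F₁ (λ σ → cong (λ b → 𝟙 (b ∧ σ ⊆ᵇ τ)) (xorSum≡parity F₀ (λ ρ → ψ ρ ∧ ρ ⊆ᵇ σ)))) ⟩
      parity (ΣL F₁ (λ σ → 𝟙 (parity (inner σ) ∧ σ ⊆ᵇ τ)))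
        ≡⟨ parity-ΣL-𝟙-parity F₁ inner (_⊆ᵇ τ) ⟩
      parity (ΣL F₁ (λ σ → 𝟙 (σ ⊆ᵇ τ) * inner σ))
        ≡⟨ cong parity double-count ⟩
      parity (ΣL F₀ (λ ρ → 𝟙 (ψ ρ) * ΣL F₁ (λ σ → 𝟙 (ρ ⊆ᵇ σ ∧ σ ⊆ᵇ τ))))
        ≡⟨ parity-ΣL-even-∈ F₀ _ each-even ⟩
      false ∎
      where
      open ≡-Reasoning
      F₀ = faces X k
      F₁ = faces X (suc k)
      inner : Subset (N X) → ℕ
      inner σ = ΣL F₀ (λ ρ → 𝟙 (ψ ρ ∧ ρ ⊆ᵇ σ))
      𝟙-rotate : ∀ a b c → 𝟙 c * 𝟙 (a ∧ b) ≡ 𝟙 a * 𝟙 (b ∧ c)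
      𝟙-rotate a b c rewrite 𝟙-∧ a b | 𝟙-∧ b c = *-rotate (𝟙 a) (𝟙 b) (𝟙 c)
        where
        *-rotate : ∀ x y z → z * (y * x) ≡ x * (z * y)
        *-rotate = solve-∀
      double-count : ΣL F₁ (λ σ → 𝟙 (σ ⊆ᵇ τ) * inner σ) ≡
                     ΣL F₀ (λ ρ → 𝟙 (ψ ρ) * ΣL F₁ (λ σ → 𝟙 (ρ ⊆ᵇ σ ∧ σ ⊆ᵇ τ)))
      double-count = begin
        ΣL F₁ (λ σ → 𝟙 (σ ⊆ᵇ τ) * inner σ)
          ≡⟨ ΣL-cong F₁ (λ σ → sym (ΣL-distribˡ-* F₀ (𝟙 (σ ⊆ᵇ τ)) _)) ⟩
        ΣL F₁ (λ σ → ΣL F₀ (λ ρ → 𝟙 (σ ⊆ᵇ τ) * 𝟙 (ψ ρ ∧ ρ ⊆ᵇ σ)))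
          ≡⟨ ΣL-comm F₁ F₀ _ ⟩
        ΣL F₀ (λ ρ → ΣL F₁ (λ σ → 𝟙 (σ ⊆ᵇ τ) * 𝟙 (ψ ρ ∧ ρ ⊆ᵇ σ)))
          ≡⟨ ΣL-cong F₀ (λ ρ → trans (ΣL-cong F₁ (λ σ → 𝟙-rotate (ψ ρ) (ρ ⊆ᵇ σ) (σ ⊆ᵇ τ)))
                                     (ΣL-distribˡ-* F₁ (𝟙 (ψ ρ)) _)) ⟩
        ΣL F₀ (λ ρ → 𝟙 (ψ ρ) * ΣL F₁ (λ σ → 𝟙 (ρ ⊆ᵇ σ ∧ σ ⊆ᵇ τ))) ∎
      each-even : ∀ {ρ} → ρ ∈ F₀ → parity (𝟙 (ψ ρ) * ΣL F₁ (λ σ → 𝟙 (ρ ⊆ᵇ σ ∧ σ ⊆ᵇ τ))) ≡ false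
      each-even {ρ} ρ∈ = trans (parity-𝟙* (ψ ρ) _)
        (trans (cong (ψ ρ ∧_) (parity-faces-between k {ρ} (proj₂ (∈-faces⁻ ρ∈)) mτ ∣τ∣≡)) (∧-zeroʳ (ψ ρ)))

    cobd≡parity-facetCount : ∀ k φ {τ} → member X τ ≡ true → ∣ τ ∣ ≡ suc (suc k) →
      cobd X (suc k) φ τ ≡ parity (∑[ u < N X ] 𝟙 (lookup τ u ∧ φ (τ [ u ]≔ false)))
    cobd≡parity-facetCount k φ {τ} mτ ∣τ∣≡ = begin
      cobd X (suc k) φ τ                                                    ≡⟨ xorSum≡parity (faces X (suc k)) _ ⟩
      parity (ΣL (faces X (suc k)) (λ σ → 𝟙 (φ σ ∧ σ ⊆ᵇ τ)))                  ≡⟨ cong parity (ΣL-faces-below (suc k) mτ φ) ⟩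
      parity (ΣS (N X) (λ σ → 𝟙 (σ ⊆ᵇ τ ∧ ((suc ∣ σ ∣ ≡ᵇ suc (suc k)) ∧ φ σ))))
        ≡⟨ cong (λ s → parity (ΣS (N X) (λ σ → 𝟙 (σ ⊆ᵇ τ ∧ ((suc ∣ σ ∣ ≡ᵇ s) ∧ φ σ))))) (sym ∣τ∣≡) ⟩
      parity (ΣS (N X) (λ σ → 𝟙 (σ ⊆ᵇ τ ∧ ((suc ∣ σ ∣ ≡ᵇ ∣ τ ∣) ∧ φ σ))))    ≡⟨ cong parity (ΣS-⊆-one-less (N X) τ φ) ⟩
      parity (∑[ u < N X ] 𝟙 (lookup τ u ∧ φ (τ [ u ]≔ false)))             ∎
      where open ≡-Reasoning

    nonzero-cobd⇒¬inB : ∀ k φ {τ} → member X τ ≡ true → ∣ τ ∣ ≡ suc (suc k) →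
      cobd X (suc k) φ τ ≡ true → inB X k φ ≡ false
    nonzero-cobd⇒¬inB k φ {τ} mτ ∣τ∣≡ dφτ = or-map-false _ (allCochains X (faces X k)) differs
      where
      differs : ∀ ψ → and (map (λ σ → does (φ σ BoolP.≟ cobd X k ψ σ)) (faces X (suc k))) ≡ false
      differs ψ with and (map (λ σ → does (φ σ BoolP.≟ cobd X k ψ σ)) (faces X (suc k))) in agree
      ... | false = refl
      ... | true = contradiction (trans (sym dφτ) (trans (cobd-cong-∈ (suc k) same τ) (cobd∘cobd≡false k ψ mτ ∣τ∣≡))) (λ ())
        where
        same : ∀ {σ} → σ ∈ faces X (suc k) → φ σ ≡ cobd X k ψ σ
        same σ∈ = does-true⇒ (φ _ BoolP.≟ _) (and-map⇒ _ (faces X (suc k)) agree σ∈)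

    h≤1-by-witness : ∀ k (φ : Cochain X) → φ ∈ allCochains X (faces X (suc k)) → inB X k φ ≡ false →
      0ℚ ℚ.< norm X (suc (suc k)) (cobd X (suc k) φ) →
      (∀ φ′ → (∀ {τ} → τ ∈ faces X (suc (suc k)) → cobd X (suc k) φ′ τ ≡ cobd X (suc k) φ τ) →
              norm X (suc (suc k)) (cobd X (suc k) φ) ℚ.≤ norm X (suc k) φ′) →
      h X k ≤∞ fin 1ℚ
    h≤1-by-witness k φ φ∈ φ∉B ‖dφ‖>0 ‖dφ‖≤ =
      foldr-⊓∞-≤ _ (filterᵇ (λ ψ → not (inB X k ψ)) (allCochains X (faces X (suc k))))
        (∈-filterᵇ⁺ _ _ φ∈ (cong not φ∉B))
        (fin≤fin (divℚ≤1 _ _ ‖dφ‖≤‖[φ]‖ ‖dφ‖>0))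
      where
      ‖dφ‖≤‖[φ]‖ : norm X (suc (suc k)) (cobd X (suc k) φ) ℚ.≤ classNorm X k φ
      ‖dφ‖≤‖[φ]‖ = foldr-⊓-glb (allCochains X (faces X k)) _ (‖dφ‖≤ φ (λ _ → refl)) λ ψ →
        ‖dφ‖≤ (_⊕_ {X} φ (cobd X k ψ)) λ {τ} τ∈ →
          let mτ , ∣τ∣≡ = ∈-faces⁻ τ∈ in
          trans (cobd-⊕ (suc k) φ (cobd X k ψ) τ)
                (trans (cong (cobd X (suc k) φ τ xor_) (cobd∘cobd≡false k ψ mτ ∣τ∣≡)) (xor-identityʳ _))

count< : ℕ → (ℕ → Bool) → ℕ
count< zero P = 0
count< (suc b) P = 𝟙 (P 0) + count< b (λ r → P (suc r))

count<-+ : ∀ a b P → count< (a + b) P ≡ count< a P + count< b (λ r → P (a + r))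
count<-+ zero b P = refl
count<-+ (suc a) b P = trans (cong (𝟙 (P 0) +_) (count<-+ a b (λ r → P (suc r)))) (sym (ℕP.+-assoc (𝟙 (P 0)) _ _))

count<-cong : ∀ b {P Q : ℕ → Bool} → (∀ {r} → r < b → P r ≡ Q r) → count< b P ≡ count< b Q
count<-cong zero e = refl
count<-cong (suc b) e = cong₂ _+_ (cong 𝟙 (e (s≤s z≤n))) (count<-cong b (λ r<b → e (s≤s r<b)))

count<-≡ᵇ : ∀ b t → count< b (_≡ᵇ t) ≡ 𝟙 (t <ᵇ b)
count<-≡ᵇ zero t = refl
count<-≡ᵇ (suc b) zero = cong suc (count<-false b)
  where
  count<-false : ∀ b → count< b (λ _ → false) ≡ 0
  count<-false zero = refl
  count<-false (suc b) = count<-false b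
count<-≡ᵇ (suc b) (suc t) = count<-≡ᵇ b t

count<-mod : ∀ q K t → t < suc K → count< (q * suc K) (λ r → r % suc K ≡ᵇ t) ≡ q
count<-mod zero K t t<K = refl
count<-mod (suc q) K t t<K = begin
  count< (suc K + q * suc K) (λ r → r % suc K ≡ᵇ t)
    ≡⟨ count<-+ (suc K) (q * suc K) (λ r → r % suc K ≡ᵇ t) ⟩
  count< (suc K) (λ r → r % suc K ≡ᵇ t) + count< (q * suc K) (λ r → (suc K + r) % suc K ≡ᵇ t)
    ≡⟨ cong₂ _+_ one-period (trans (count<-cong (q * suc K) (λ {r} _ → cong (_≡ᵇ t) (shift r))) (count<-mod q K t t<K)) ⟩
  1 + q ∎
  where
  open ≡-Reasoning
  shift : ∀ r → (suc K + r) % suc K ≡ r % suc K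
  shift r = trans (cong (_% suc K) (ℕP.+-comm (suc K) r)) ([m+n]%n≡m%n r (suc K))
  one-period : count< (suc K) (λ r → r % suc K ≡ᵇ t) ≡ 1
  one-period = trans (count<-cong (suc K) (λ r<K → cong (_≡ᵇ t) (m<n⇒m%n≡m r<K)))
                     (trans (count<-≡ᵇ (suc K) t) (cong 𝟙 (<⇒<ᵇ-true t (suc K) t<K)))

-- rank g v: the number of vertices before v in the same block as v.
rank : ∀ {N A} → (Fin N → Fin A) → Fin N → ℕ
rank g fz = 0
rank g (fs v) = 𝟙 (does (g (fs v) FinP.≟ g fz)) + rank (λ w → g (fs w)) v

-- rank enumerates each block bijectively by 0, 1, …, |block| - 1.
∑-rank : ∀ {N A} (g : Fin N → Fin (suc A)) i (P : ℕ → Bool) →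
  ∑[ v < N ] 𝟙 (does (g v FinP.≟ i) ∧ P (rank g v)) ≡ count< ∣ block g i ∣ P
∑-rank {zero} g i P = refl
∑-rank {suc N} g i P with g fz FinP.≟ i
... | yes g0≡i = cong (𝟙 (P 0) +_) (trans (sum-cong-≗ later) (∑-rank (λ w → g (fs w)) i (λ r → P (suc r))))
  where
  later : ∀ v → 𝟙 (does (g (fs v) FinP.≟ i) ∧ P (rank g (fs v))) ≡ 𝟙 (does (g (fs v) FinP.≟ i) ∧ P (suc (rank (λ w → g (fs w)) v)))
  later v with g (fs v) FinP.≟ i
  ... | no _ = refl
  ... | yes gv≡i rewrite dec-true (g (fs v) FinP.≟ g fz) (trans gv≡i (sym g0≡i)) = refl
... | no g0≢i = trans (sum-cong-≗ later) (∑-rank (λ w → g (fs w)) i P)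
  where
  later : ∀ v → 𝟙 (does (g (fs v) FinP.≟ i) ∧ P (rank g (fs v))) ≡ 𝟙 (does (g (fs v) FinP.≟ i) ∧ P (rank (λ w → g (fs w)) v))
  later v with g (fs v) FinP.≟ i
  ... | no _ = refl
  ... | yes gv≡i rewrite dec-false (g (fs v) FinP.≟ g fz) (λ gv≡g0 → g0≢i (trans (sym gv≡g0) gv≡i)) = refl

module _ {N A} (g : Fin N → Fin (suc A)) (K : ℕ) where

  colour : Fin N → Fin (suc K)
  colour v = fromℕ< (m%n<n (rank g v) (suc K))

  toℕ-colour : ∀ v → toℕ (colour v) ≡ rank g v % suc K
  toℕ-colour v = FinP.toℕ-fromℕ< _

  colour-balanced : ∀ q → (∀ i → ∣ block g i ∣ ≡ q * suc K) →
    ∀ i j → ∑[ v < N ] 𝟙 (does (g v FinP.≟ i) ∧ does (colour v FinP.≟ j)) ≡ q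
  colour-balanced q ∣block∣≡ i j = begin
    ∑[ v < N ] 𝟙 (does (g v FinP.≟ i) ∧ does (colour v FinP.≟ j))
      ≡⟨ sum-cong-≗ (λ v → cong (λ b → 𝟙 (does (g v FinP.≟ i) ∧ b)) (colour≟ v)) ⟩
    ∑[ v < N ] 𝟙 (does (g v FinP.≟ i) ∧ (rank g v % suc K ≡ᵇ toℕ j))
      ≡⟨ ∑-rank g i (λ r → r % suc K ≡ᵇ toℕ j) ⟩
    count< ∣ block g i ∣ (λ r → r % suc K ≡ᵇ toℕ j)
      ≡⟨ cong (λ b → count< b (λ r → r % suc K ≡ᵇ toℕ j)) (∣block∣≡ i) ⟩
    count< (q * suc K) (λ r → r % suc K ≡ᵇ toℕ j)
      ≡⟨ count<-mod q K (toℕ j) (FinP.toℕ<n j) ⟩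
    q ∎
    where
    open ≡-Reasoning
    colour≟ : ∀ v → does (colour v FinP.≟ j) ≡ (rank g v % suc K ≡ᵇ toℕ j)
    colour≟ v = trans (does-Fin-≟ (colour v) j) (cong (_≡ᵇ toℕ j) (toℕ-colour v))

  ∑-balanced : ∀ q → (∀ i → ∣ block g i ∣ ≡ q * suc K) → (a : Fin (suc A) → Bool) (b : Fin (suc K) → Bool) →
    ∑[ v < N ] 𝟙 (a (g v) ∧ b (colour v)) ≡ q * ∑[ i < suc A ] 𝟙 (a i) * ∑[ j < suc K ] 𝟙 (b j)
  ∑-balanced q ∣block∣≡ a b = begin
    ∑[ v < N ] 𝟙 (a (g v) ∧ b (colour v))
      ≡⟨ ∑-fibres g colour (λ i j → 𝟙 (a i ∧ b j)) ⟩
    ∑[ i < suc A ] ∑[ j < suc K ] (𝟙 (a i ∧ b j) * ∑[ v < N ] 𝟙 (does (g v FinP.≟ i) ∧ does (colour v FinP.≟ j)))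
      ≡⟨ sum-cong-≗ (λ i → sum-cong-≗ (λ j → cong (𝟙 (a i ∧ b j) *_) (colour-balanced q ∣block∣≡ i j))) ⟩
    ∑[ i < suc A ] ∑[ j < suc K ] (𝟙 (a i ∧ b j) * q)
      ≡⟨ sum-cong-≗ (λ i → trans (sum-cong-≗ (λ j → split (a i) (b j))) (sym (*-distribˡ-sum (q * 𝟙 (a i)) (λ j → 𝟙 (b j))))) ⟩
    ∑[ i < suc A ] (q * 𝟙 (a i) * ∑[ j < suc K ] 𝟙 (b j))
      ≡⟨ sym (*-distribʳ-sum (∑[ j < suc K ] 𝟙 (b j)) (λ i → q * 𝟙 (a i))) ⟩
    ∑[ i < suc A ] (q * 𝟙 (a i)) * ∑[ j < suc K ] 𝟙 (b j)
      ≡⟨ cong (_* ∑[ j < suc K ] 𝟙 (b j)) (sym (*-distribˡ-sum q (λ i → 𝟙 (a i)))) ⟩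
    q * ∑[ i < suc A ] 𝟙 (a i) * ∑[ j < suc K ] 𝟙 (b j) ∎
    where
    open ≡-Reasoning
    split : ∀ x y → 𝟙 (x ∧ y) * q ≡ q * 𝟙 x * 𝟙 y
    split x y rewrite 𝟙-∧ x y = *-reorder (𝟙 x) (𝟙 y) q
      where
      *-reorder : ∀ x y z → y * x * z ≡ z * x * y
      *-reorder = solve-∀

module Rainbow {N K : ℕ} (col : Fin N → Fin (suc K)) where

  hasProfile : (Fin (suc K) → ℕ) → Subset N → Bool
  hasProfile p σ = and (map (λ j → blockCount σ col j ≡ᵇ p j) (allFin (suc K)))

  hasProfile⁻ : ∀ p σ → hasProfile p σ ≡ true → ∀ j → blockCount σ col j ≡ p j
  hasProfile⁻ p σ e j = ≡ᵇ-true⇒≡ _ _ (and-allFin⇒ (λ j → blockCount σ col j ≡ᵇ p j) e j)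

  hasProfile⁺ : ∀ p σ → (∀ j → blockCount σ col j ≡ p j) → hasProfile p σ ≡ true
  hasProfile⁺ p σ h = and-map⇐ (λ j → blockCount σ col j ≡ᵇ p j) (allFin (suc K)) (λ j → ≡⇒≡ᵇ-true _ _ (h j))

  facetCount : (Fin (suc K) → ℕ) → Subset N → ℕ
  facetCount p τ = ∑[ u < N ] 𝟙 (lookup τ u ∧ hasProfile p (τ [ u ]≔ false))

  blockCount-remove : ∀ τ u → lookup τ u ≡ true → ∀ j →
    blockCount τ col j ≡ blockCount (τ [ u ]≔ false) col j + 𝟙 (does (col u FinP.≟ j))
  blockCount-remove τ u u∈τ j = trans (∣remove∩∣ τ (block col j) u u∈τ)
    (cong (λ b → blockCount (τ [ u ]≔ false) col j + 𝟙 b) (lookup-block col j u))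

  -- τ − u has profile p exactly when u has colour c.
  facetCount-one-extra : ∀ p τ c → (∀ j → blockCount τ col j ≡ p j + 𝟙 (does (c FinP.≟ j))) →
    facetCount p τ ≡ blockCount τ col c
  facetCount-one-extra p τ c profile = trans (sum-cong-≗ removable) (sym (blockCount≡∑ τ col c))
    where
    removable : ∀ u → 𝟙 (lookup τ u ∧ hasProfile p (τ [ u ]≔ false)) ≡ 𝟙 (lookup τ u ∧ does (col u FinP.≟ c))
    removable u with lookup τ u in u∈τ
    ... | false = refl
    ... | true = cong 𝟙 same
      where
      rest : ∀ j → blockCount (τ [ u ]≔ false) col j + 𝟙 (does (col u FinP.≟ j)) ≡ p j + 𝟙 (does (c FinP.≟ j))
      rest j = trans (sym (blockCount-remove τ u u∈τ j)) (profile j)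
      same : hasProfile p (τ [ u ]≔ false) ≡ does (col u FinP.≟ c)
      same with col u FinP.≟ c
      ... | yes refl = hasProfile⁺ p (τ [ u ]≔ false) (λ j → ℕP.+-cancelʳ-≡ (𝟙 (does (col u FinP.≟ j))) _ _ (rest j))
      ... | no u≢c with hasProfile p (τ [ u ]≔ false) in has-p
      ...   | false = refl
      ...   | true = contradiction (begin
        p c
          ≡⟨ sym (hasProfile⁻ p (τ [ u ]≔ false) has-p c) ⟩
        blockCount (τ [ u ]≔ false) col c
          ≡⟨ sym (trans (cong (λ b → blockCount (τ [ u ]≔ false) col c + 𝟙 b) (dec-false (col u FinP.≟ c) u≢c))
                        (ℕP.+-identityʳ _)) ⟩
        blockCount (τ [ u ]≔ false) col c + 𝟙 (does (col u FinP.≟ c))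
          ≡⟨ rest c ⟩
        p c + 𝟙 (does (c FinP.≟ c))
          ≡⟨ cong (λ b → p c + 𝟙 b) (dec-true (c FinP.≟ c) refl) ⟩
        p c + 1
          ≡⟨ ℕP.+-comm (p c) 1 ⟩
        suc (p c) ∎) (ℕP.1+n≢n ∘ sym)
        where open ≡-Reasoning

  lastColour : Fin (suc K)
  lastColour = fromℕ K

  allButLast : Fin (suc K) → ℕ
  allButLast j = if does (j FinP.≟ lastColour) then 0 else 1

  isRainbow : Subset N → Bool
  isRainbow = hasProfile (λ _ → 1)

  allButLast+last : ∀ j → allButLast j + 𝟙 (does (lastColour FinP.≟ j)) ≡ 1
  allButLast+last j with j FinP.≟ lastColour | lastColour FinP.≟ j
  ... | yes _ | yes _ = refl
  ... | no _ | no _ = refl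
  ... | yes j≡l | no l≢j = contradiction (sym j≡l) l≢j
  ... | no j≢l | yes l≡j = contradiction (sym l≡j) j≢l

  rainbow⇒facetCount≡1 : ∀ τ → isRainbow τ ≡ true → facetCount allButLast τ ≡ 1
  rainbow⇒facetCount≡1 τ rainbow = trans
    (facetCount-one-extra allButLast τ lastColour (λ j → trans (hasProfile⁻ _ τ rainbow j) (sym (allButLast+last j))))
    (hasProfile⁻ _ τ rainbow lastColour)

  -- If the removable vertex u had a colour c ≠ last, τ would have two vertices of colour c, both removable.
  odd-facetCount⇒rainbow : ∀ τ → parity (facetCount allButLast τ) ≡ true → isRainbow τ ≡ true
  odd-facetCount⇒rainbow τ odd with ∑-𝟙∧-pos⇒∃ (lookup τ) (λ u → hasProfile allButLast (τ [ u ]≔ false)) (parity-true⇒pos odd)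
  ... | u , u∈τ , τ-u = rainbow (col u FinP.≟ lastColour)
    where
    profile : ∀ j → blockCount τ col j ≡ allButLast j + 𝟙 (does (col u FinP.≟ j))
    profile j = trans (blockCount-remove τ u u∈τ j) (cong (_+ 𝟙 (does (col u FinP.≟ j))) (hasProfile⁻ allButLast (τ [ u ]≔ false) τ-u j))
    rainbow : Dec (col u ≡ lastColour) → isRainbow τ ≡ true
    rainbow (yes u-last) = hasProfile⁺ _ τ λ j →
      trans (profile j) (trans (cong (λ c → allButLast j + 𝟙 (does (c FinP.≟ j))) u-last) (allButLast+last j))
    rainbow (no u-not-last) = contradiction (trans (sym odd) (cong parity two)) (λ ())
      where
      two : facetCount allButLast τ ≡ 2
      two = begin
        facetCount allButLast τ
          ≡⟨ facetCount-one-extra allButLast τ (col u) profile ⟩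
        blockCount τ col (col u)
          ≡⟨ profile (col u) ⟩
        allButLast (col u) + 𝟙 (does (col u FinP.≟ col u))
          ≡⟨ cong₂ (λ a b → (if a then 0 else 1) + 𝟙 b) (dec-false (col u FinP.≟ lastColour) u-not-last)
                                                      (dec-true (col u FinP.≟ col u) refl) ⟩
        2 ∎
        where open ≡-Reasoning

module _ {n N : ℕ} (part : Fin N → Fin (suc n)) where

  private
    X = Xnm n N part

  member-Xnm⁻ : ∀ σ → member X σ ≡ true → ∀ i → blockCount σ part i ≤ 1
  member-Xnm⁻ σ e i = ≤ᵇ-true⇒≤ _ 1 (and-allFin⇒ (λ i → ∣ σ ∩ block part i ∣ ≤ᵇ 1) e i)

  member-Xnm⁺ : ∀ σ → (∀ i → blockCount σ part i ≤ 1) → member X σ ≡ true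
  member-Xnm⁺ σ h = and-map⇐ (λ i → ∣ σ ∩ block part i ∣ ≤ᵇ 1) (allFin (suc n)) (λ i → ≤⇒≤ᵇ-true _ 1 (h i))

  Xnm-downClosed : DownClosed X
  Xnm-downClosed σ τ σ⊆τ mτ = member-Xnm⁺ σ (λ i → ℕP.≤-trans (⊆ᵇ-∩-mono σ τ (block part i) σ⊆τ) (member-Xnm⁻ τ mτ i))

  isFacet : Subset N → Bool
  isFacet T = (∣ T ∣ ≡ᵇ suc n) ∧ member X T

  facet-meets-each-block : ∀ {T} → isFacet T ≡ true → ∀ i → blockCount T part i ≡ 1
  facet-meets-each-block {T} e = ∑≡N⇒≡1 (blockCount T part)
    (trans (sym (∣∣≡∑-blockCount T part)) (≡ᵇ-true⇒≡ _ _ (∧-conicalˡ _ _ e))) (member-Xnm⁻ T (∧-conicalʳ (∣ T ∣ ≡ᵇ suc n) _ e))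

  facetsAbove : Subset N → ℕ
  facetsAbove σ = ΣS N (λ T → 𝟙 (σ ⊆ᵇ T ∧ isFacet T))

  c≡facetsAbove : ∀ σ → c X σ ≡ facetsAbove σ
  c≡facetsAbove σ = begin
    c X σ
      ≡⟨ length-filterᵇ (σ ⊆ᵇ_) (faces X (suc n)) ⟩
    ΣL (faces X (suc n)) (λ T → 𝟙 (true ∧ σ ⊆ᵇ T))
      ≡⟨ ΣL-faces-above X (suc n) σ (λ _ → true) ⟩
    ΣS N (λ T → 𝟙 (σ ⊆ᵇ T ∧ ((∣ T ∣ ≡ᵇ suc n) ∧ (member X T ∧ true))))
      ≡⟨ ΣL-cong (allSubsets N) (λ T → cong (λ b → 𝟙 (σ ⊆ᵇ T ∧ ((∣ T ∣ ≡ᵇ suc n) ∧ b))) (∧-identityʳ _)) ⟩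
    facetsAbove σ ∎
    where open ≡-Reasoning

  -- A facet meets block i in exactly one vertex, so it is counted once on the right.
  facet-indicator-by-block : ∀ σ i T → 𝟙 (σ ⊆ᵇ T ∧ isFacet T) ≡
    ∑[ v < N ] (𝟙 (does (part v FinP.≟ i)) * 𝟙 ((σ [ v ]≔ true) ⊆ᵇ T ∧ isFacet T))
  facet-indicator-by-block σ i T with isFacet T in facet
  ... | false = trans (cong 𝟙 (∧-zeroʳ _)) (sym (∑-0 λ v →
    trans (cong (λ b → 𝟙 (does (part v FinP.≟ i)) * 𝟙 b) (∧-zeroʳ ((σ [ v ]≔ true) ⊆ᵇ T))) (ℕP.*-zeroʳ (𝟙 (does (part v FinP.≟ i))))))
  ... | true = begin
    𝟙 (σ ⊆ᵇ T ∧ true)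
      ≡⟨ cong 𝟙 (∧-identityʳ _) ⟩
    𝟙 (σ ⊆ᵇ T)
      ≡⟨ sym (trans (cong (𝟙 (σ ⊆ᵇ T) *_) (trans (sym (blockCount≡∑ T part i)) (facet-meets-each-block {T} facet i))) (ℕP.*-identityʳ _)) ⟩
    𝟙 (σ ⊆ᵇ T) * ∑[ v < N ] 𝟙 (lookup T v ∧ does (part v FinP.≟ i))
      ≡⟨ *-distribˡ-sum (𝟙 (σ ⊆ᵇ T)) (λ v → 𝟙 (lookup T v ∧ does (part v FinP.≟ i))) ⟩
    ∑[ v < N ] (𝟙 (σ ⊆ᵇ T) * 𝟙 (lookup T v ∧ does (part v FinP.≟ i)))
      ≡⟨ sum-cong-≗ (λ v → sym (insert v)) ⟩
    ∑[ v < N ] (𝟙 (does (part v FinP.≟ i)) * 𝟙 ((σ [ v ]≔ true) ⊆ᵇ T ∧ true)) ∎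
    where
    open ≡-Reasoning
    reorder : ∀ a b c → 𝟙 c * 𝟙 ((a ∧ b) ∧ true) ≡ 𝟙 a * 𝟙 (b ∧ c)
    reorder a b c rewrite ∧-identityʳ (a ∧ b) | 𝟙-∧ a b | 𝟙-∧ b c = *-reorder (𝟙 a) (𝟙 b) (𝟙 c)
      where
      *-reorder : ∀ x y z → z * (y * x) ≡ x * (z * y)
      *-reorder = solve-∀
    insert : ∀ v → 𝟙 (does (part v FinP.≟ i)) * 𝟙 ((σ [ v ]≔ true) ⊆ᵇ T ∧ true) ≡
                   𝟙 (σ ⊆ᵇ T) * 𝟙 (lookup T v ∧ does (part v FinP.≟ i))
    insert v rewrite insert-⊆ᵇ σ T v = reorder (σ ⊆ᵇ T) (lookup T v) _

  facetsAbove-by-block : ∀ σ i → facetsAbove σ ≡ ∑[ v < N ] (𝟙 (does (part v FinP.≟ i)) * facetsAbove (σ [ v ]≔ true))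
  facetsAbove-by-block σ i = begin
    ΣS N (λ T → 𝟙 (σ ⊆ᵇ T ∧ isFacet T))
      ≡⟨ ΣL-cong (allSubsets N) (facet-indicator-by-block σ i) ⟩
    ΣS N (λ T → ∑[ v < N ] (𝟙 (does (part v FinP.≟ i)) * 𝟙 ((σ [ v ]≔ true) ⊆ᵇ T ∧ isFacet T)))
      ≡⟨ ΣL-∑-comm (allSubsets N) N _ ⟩
    ∑[ v < N ] ΣS N (λ T → 𝟙 (does (part v FinP.≟ i)) * 𝟙 ((σ [ v ]≔ true) ⊆ᵇ T ∧ isFacet T))
      ≡⟨ sum-cong-≗ (λ v → ΣL-distribˡ-* (allSubsets N) (𝟙 (does (part v FinP.≟ i))) _) ⟩
    ∑[ v < N ] (𝟙 (does (part v FinP.≟ i)) * facetsAbove (σ [ v ]≔ true)) ∎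
    where open ≡-Reasoning

  module _ (σ : Subset N) (i : Fin (suc n)) (misses : blockCount σ part i ≡ 0) (v : Fin N) (v∈Vᵢ : part v ≡ i) where

    ∉-missed-block : lookup σ v ≡ false
    ∉-missed-block = 𝟙≡0⇒false (trans (cong 𝟙 (sym (trans (cong (lookup σ v ∧_) (dec-true (part v FinP.≟ i) v∈Vᵢ)) (∧-identityʳ _))))
      (∑≡0⇒≡0 (λ v → 𝟙 (lookup σ v ∧ does (part v FinP.≟ i))) (trans (sym (blockCount≡∑ σ part i)) misses) v))

    blockCount-insert : ∀ j → blockCount (σ [ v ]≔ true) part j ≡ blockCount σ part j + 𝟙 (does (part v FinP.≟ j))
    blockCount-insert j = trans (∣insert∩∣ σ (block part j) v ∉-missed-block) (cong (λ b → blockCount σ part j + 𝟙 b) (lookup-block part j v))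

    member-insert : member X σ ≡ true → member X (σ [ v ]≔ true) ≡ true
    member-insert mσ = member-Xnm⁺ (σ [ v ]≔ true) (λ j → subst (_≤ 1) (sym (blockCount-insert j)) (at-most-one j))
      where
      at-most-one : ∀ j → blockCount σ part j + 𝟙 (does (part v FinP.≟ j)) ≤ 1
      at-most-one j with part v FinP.≟ j
      ... | yes refl = subst (λ c → c + 1 ≤ 1) (sym (subst (λ a → blockCount σ part a ≡ 0) (sym v∈Vᵢ) misses)) ℕP.≤-refl
      ... | no _ = subst (_≤ 1) (sym (ℕP.+-identityʳ _)) (member-Xnm⁻ σ mσ j)

  module _ {m} (∣Vᵢ∣≡m : ∀ i → ∣ block part i ∣ ≡ m) where

    ∑-block≡m : ∀ i → ∑[ v < N ] 𝟙 (does (part v FinP.≟ i)) ≡ m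
    ∑-block≡m i = trans (sym (trans (∣∣≡∑ (block part i)) (sum-cong-≗ (λ v → cong 𝟙 (lookup-block part i v))))) (∣Vᵢ∣≡m i)

    -- Induction on the number u of missing blocks: a missed block offers m ways to extend.
    facetsAbove≡m^ : ∀ u σ → member X σ ≡ true → ∣ σ ∣ + u ≡ suc n → facetsAbove σ ≡ m ^ u
    facetsAbove≡m^ zero σ mσ ∣σ∣≡ =
      trans (ΣL-cong (allSubsets N) (λ T → cong (λ s → 𝟙 (σ ⊆ᵇ T ∧ ((∣ T ∣ ≡ᵇ s) ∧ member X T))) (sym ∣σ∣≡n+1)))
            (trans (ΣS-⊇-same-size N σ (member X)) (cong 𝟙 mσ))
      where ∣σ∣≡n+1 = trans (sym (ℕP.+-identityʳ _)) ∣σ∣≡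
    facetsAbove≡m^ (suc u) σ mσ ∣σ∣≡ = begin
      facetsAbove σ
        ≡⟨ facetsAbove-by-block σ i ⟩
      ∑[ v < N ] (𝟙 (does (part v FinP.≟ i)) * facetsAbove (σ [ v ]≔ true))
        ≡⟨ sum-cong-≗ extend ⟩
      ∑[ v < N ] (m ^ u * 𝟙 (does (part v FinP.≟ i)))
        ≡⟨ sym (*-distribˡ-sum (m ^ u) (λ v → 𝟙 (does (part v FinP.≟ i)))) ⟩
      m ^ u * ∑[ v < N ] 𝟙 (does (part v FinP.≟ i))
        ≡⟨ cong (m ^ u *_) (∑-block≡m i) ⟩
      m ^ u * m
        ≡⟨ ℕP.*-comm (m ^ u) m ⟩
      m ^ suc u ∎
      where
      open ≡-Reasoning
      ∑<n+1 : ∑[ j < suc n ] blockCount σ part j < suc n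
      ∑<n+1 = subst (_< suc n) (∣∣≡∑-blockCount σ part)
        (subst (∣ σ ∣ <_) ∣σ∣≡ (subst (_≤ ∣ σ ∣ + suc u) (ℕP.+-comm ∣ σ ∣ 1) (ℕP.+-monoʳ-≤ ∣ σ ∣ (s≤s z≤n))))
      missed = ∑<N⇒∃≡0 (blockCount σ part) ∑<n+1
      i = proj₁ missed
      extend : ∀ v → 𝟙 (does (part v FinP.≟ i)) * facetsAbove (σ [ v ]≔ true) ≡ m ^ u * 𝟙 (does (part v FinP.≟ i))
      extend v with part v FinP.≟ i
      ... | no _ = sym (ℕP.*-zeroʳ (m ^ u))
      ... | yes v∈Vᵢ = trans (ℕP.+-identityʳ _) (trans
        (facetsAbove≡m^ u (σ [ v ]≔ true) (member-insert σ i (proj₂ missed) v v∈Vᵢ mσ)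
          (trans (cong (_+ u) (∣insert∣ σ v (∉-missed-block σ i (proj₂ missed) v v∈Vᵢ))) (trans (sym (ℕP.+-suc ∣ σ ∣ u)) ∣σ∣≡)))
        (sym (ℕP.*-identityʳ (m ^ u))))

    fTop≡m^ : fTop X ≡ m ^ suc n
    fTop≡m^ = begin
      length (faces X (suc n))                          ≡⟨ length≡ΣL-1 (faces X (suc n)) ⟩
      ΣL (faces X (suc n)) (λ _ → 1)                     ≡⟨ ΣL-cong (faces X (suc n)) (λ T → cong 𝟙 (sym (⊥⊆ᵇ T))) ⟩
      ΣL (faces X (suc n)) (λ T → 𝟙 (⊥ ⊆ᵇ T))           ≡⟨ sym (length-filterᵇ (⊥ ⊆ᵇ_) (faces X (suc n))) ⟩
      c X ⊥                                             ≡⟨ c≡facetsAbove ⊥ ⟩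
      facetsAbove ⊥                                     ≡⟨ facetsAbove≡m^ (suc n) ⊥ member-⊥ (cong (_+ suc n) (∣⊥∣≡0 N)) ⟩
      m ^ suc n                                         ∎
      where
      open ≡-Reasoning
      member-⊥ : member X ⊥ ≡ true
      member-⊥ = member-Xnm⁺ ⊥ (λ i → subst (_≤ 1) (sym (trans (cong ∣_∣ (∩-zeroˡ (block part i))) (∣⊥∣≡0 N))) z≤n)

    -- The denominator binom(n+1, s) f_n(X) of the weight of a face of size s.
    weightDenominator : ℕ → ℕ
    weightDenominator s = (suc n C s) * m ^ suc n

    module _ (1≤m : 1 ≤ m) where

      1≤weightDenominator : ∀ s → s ≤ suc n → 1 ≤ weightDenominator s
      1≤weightDenominator s s≤ = ℕP.*-mono-≤ (1≤nCk (suc n) s s≤) (ℕP.m^n>0 m {{ℕ.>-nonZero 1≤m}} (suc n))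

      norm-Xnm : ∀ s u φ → s + u ≡ suc n →
        norm X s φ ≡ (length (filterᵇ φ (faces X s)) * m ^ u) /suc ℕ.pred (weightDenominator s)
      norm-Xnm s u φ s+u≡ = sumℚ-const (filterᵇ φ (faces X s)) (w X s) (m ^ u) _ weight
        where
        weight : ∀ {σ} → σ ∈ filterᵇ φ (faces X s) → w X s σ ≡ (m ^ u) /suc ℕ.pred (weightDenominator s)
        weight {σ} σ∈ = let mσ , ∣σ∣≡s = ∈-faces⁻ X (proj₂ (∈-filterᵇ⁻ φ (faces X s) σ∈)) in
          trans (cong₂ divℕ (trans (c≡facetsAbove σ) (facetsAbove≡m^ u σ mσ (trans (cong (_+ u) ∣σ∣≡s) s+u≡)))
                            (cong ((suc n C s) *_) fTop≡m^))
                (divℕ≡/suc (m ^ u) _ (1≤weightDenominator s (subst (s ≤_) s+u≡ (ℕP.m≤m+n s u))))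

module _ {n N : ℕ} (part : Fin N → Fin (suc n)) {m} (∣Vᵢ∣≡m : ∀ i → ∣ block part i ∣ ≡ m) where

  -- The vertex of rank i in block i, for each i < c.
  diagonal : ℕ → Subset N
  diagonal c = tabulate (λ v → (rank part v ≡ᵇ toℕ (part v)) ∧ (toℕ (part v) <ᵇ c))

  blockCount-diagonal : ∀ {c} → c ≤ m → ∀ i → blockCount (diagonal c) part i ≡ 𝟙 (toℕ i <ᵇ c)
  blockCount-diagonal {c} c≤m i = begin
    blockCount (diagonal c) part i
      ≡⟨ blockCount≡∑ (diagonal c) part i ⟩
    ∑[ v < N ] 𝟙 (lookup (diagonal c) v ∧ does (part v FinP.≟ i))
      ≡⟨ sum-cong-≗ in-block ⟩
    ∑[ v < N ] (𝟙 (toℕ i <ᵇ c) * 𝟙 (does (part v FinP.≟ i) ∧ (rank part v ≡ᵇ toℕ i)))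
      ≡⟨ sym (*-distribˡ-sum (𝟙 (toℕ i <ᵇ c)) (λ v → 𝟙 (does (part v FinP.≟ i) ∧ (rank part v ≡ᵇ toℕ i)))) ⟩
    𝟙 (toℕ i <ᵇ c) * ∑[ v < N ] 𝟙 (does (part v FinP.≟ i) ∧ (rank part v ≡ᵇ toℕ i))
      ≡⟨ cong (𝟙 (toℕ i <ᵇ c) *_) (trans (∑-rank part i (_≡ᵇ toℕ i))
           (trans (cong (λ b → count< b (_≡ᵇ toℕ i)) (∣Vᵢ∣≡m i)) (count<-≡ᵇ m (toℕ i)))) ⟩
    𝟙 (toℕ i <ᵇ c) * 𝟙 (toℕ i <ᵇ m)
      ≡⟨ below-c (toℕ i <ᵇ c) refl ⟩
    𝟙 (toℕ i <ᵇ c) ∎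
    where
    open ≡-Reasoning
    below-c : ∀ b → (toℕ i <ᵇ c) ≡ b → 𝟙 b * 𝟙 (toℕ i <ᵇ m) ≡ 𝟙 b
    below-c false _ = refl
    below-c true i<c rewrite <⇒<ᵇ-true (toℕ i) m (ℕP.<-≤-trans (<ᵇ-true⇒< _ _ i<c) c≤m) = refl
    in-block : ∀ v → 𝟙 (lookup (diagonal c) v ∧ does (part v FinP.≟ i)) ≡
                     𝟙 (toℕ i <ᵇ c) * 𝟙 (does (part v FinP.≟ i) ∧ (rank part v ≡ᵇ toℕ i))
    in-block v rewrite lookup∘tabulate (λ v → (rank part v ≡ᵇ toℕ (part v)) ∧ (toℕ (part v) <ᵇ c)) v with part v FinP.≟ i
    ... | yes refl = trans (cong 𝟙 (∧-identityʳ _)) (𝟙-∧ (rank part v ≡ᵇ toℕ i) (toℕ i <ᵇ c))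
    ... | no _ = trans (cong 𝟙 (∧-zeroʳ _)) (sym (ℕP.*-zeroʳ (𝟙 (toℕ i <ᵇ c))))

  ∣diagonal∣ : ∀ {c} → c ≤ m → c ≤ suc n → ∣ diagonal c ∣ ≡ c
  ∣diagonal∣ {c} c≤m c≤n+1 =
    trans (∣∣≡∑-blockCount (diagonal c) part) (trans (sum-cong-≗ (blockCount-diagonal c≤m)) (∑-𝟙-<ᵇ c c≤n+1))

  member-diagonal : ∀ {c} → c ≤ m → member (Xnm n N part) (diagonal c) ≡ true
  member-diagonal {c} c≤m = member-Xnm⁺ part (diagonal c) (λ i → subst (_≤ 1) (sym (blockCount-diagonal c≤m i)) (𝟙≤1 _))

  toℕ-colour-diagonal : ∀ K v → lookup (diagonal (suc K)) v ≡ true → toℕ (colour part K v) ≡ toℕ (part v)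
  toℕ-colour-diagonal K v v∈D = trans (toℕ-colour part K v) (trans (m<n⇒m%n≡m rank<K) rank≡)
    where
    on-diagonal = trans (sym (lookup∘tabulate _ v)) v∈D
    rank≡ : rank part v ≡ toℕ (part v)
    rank≡ = ≡ᵇ-true⇒≡ _ _ (∧-conicalˡ _ _ on-diagonal)
    rank<K : rank part v < suc K
    rank<K = subst (_< suc K) (sym rank≡) (<ᵇ-true⇒< _ _ (∧-conicalʳ _ _ on-diagonal))

  diagonal-rainbow : ∀ K → suc K ≤ m → suc K ≤ suc n →
    Rainbow.isRainbow (colour part K) (diagonal (suc K)) ≡ true
  diagonal-rainbow K K≤m K≤n+1 = Rainbow.hasProfile⁺ (colour part K) _ D once
    where
    D = diagonal (suc K)
    once : ∀ j → blockCount D (colour part K) j ≡ 1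
    once j = begin
      blockCount D (colour part K) j                              ≡⟨ blockCount≡∑ D (colour part K) j ⟩
      ∑[ v < N ] 𝟙 (lookup D v ∧ does (colour part K v FinP.≟ j))  ≡⟨ sum-cong-≗ colour≡block ⟩
      ∑[ v < N ] 𝟙 (lookup D v ∧ does (part v FinP.≟ j′))         ≡⟨ sym (blockCount≡∑ D part j′) ⟩
      blockCount D part j′                                        ≡⟨ blockCount-diagonal K≤m j′ ⟩
      𝟙 (toℕ j′ <ᵇ suc K)                                         ≡⟨ cong 𝟙 (<⇒<ᵇ-true _ _ (subst (_< suc K) (sym toℕ-j′) (FinP.toℕ<n j))) ⟩
      1 ∎
      where
      open ≡-Reasoning
      j<n+1 = ℕP.<-≤-trans (FinP.toℕ<n j) K≤n+1
      j′ : Fin (suc n)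
      j′ = fromℕ< j<n+1
      toℕ-j′ : toℕ j′ ≡ toℕ j
      toℕ-j′ = FinP.toℕ-fromℕ< j<n+1
      colour≡block : ∀ v → 𝟙 (lookup D v ∧ does (colour part K v FinP.≟ j)) ≡ 𝟙 (lookup D v ∧ does (part v FinP.≟ j′))
      colour≡block v with lookup D v in v∈D
      ... | false = refl
      ... | true = cong 𝟙 (trans (does-Fin-≟ (colour part K v) j)
        (trans (cong₂ _≡ᵇ_ (toℕ-colour-diagonal K v v∈D) (sym toℕ-j′)) (sym (does-Fin-≟ (part v) j′))))

-- r + 1 = n − k is the number of blocks a k-face misses, and q = m / (k + 2).
module Construction {n N : ℕ} (part : Fin N → Fin (suc n)) {m} (∣Vᵢ∣≡m : ∀ i → ∣ block part i ∣ ≡ m)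
                    {k r q : ℕ} (n≡ : n ≡ suc (k + r)) (m≡ : m ≡ q * suc (suc k)) where

  private
    X = Xnm n N part
    K = suc (suc k)
    col = colour part (suc k)

  open Rainbow col public

  extends : Subset N → Fin N → Bool
  extends σ v = not (lookup σ v) ∧ (member X (σ [ v ]≔ true) ∧ isRainbow (σ [ v ]≔ true))

  rainbowExtensions≡∑ : ∀ σ → ∣ σ ∣ ≡ suc k →
    ΣL (faces X (suc (suc k))) (λ τ → 𝟙 (isRainbow τ ∧ σ ⊆ᵇ τ)) ≡ ∑[ v < N ] 𝟙 (extends σ v)
  rainbowExtensions≡∑ σ ∣σ∣≡ = trans (ΣL-faces-above X (suc (suc k)) σ isRainbow)
    (trans (ΣL-cong (allSubsets N) (λ τ → cong (λ s → 𝟙 (σ ⊆ᵇ τ ∧ ((∣ τ ∣ ≡ᵇ suc s) ∧ (member X τ ∧ isRainbow τ)))) (sym ∣σ∣≡)))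
           (ΣS-⊇-one-more N σ (λ τ → member X τ ∧ isRainbow τ)))

  module _ {σ v} (σ+v : extends σ v ≡ true) where

    private
      v∉σ : lookup σ v ≡ false
      v∉σ = not-injective (∧-conicalˡ (not (lookup σ v)) _ σ+v)
      member+rainbow = ∧-conicalʳ (not (lookup σ v)) _ σ+v
      rainbow : isRainbow (σ [ v ]≔ true) ≡ true
      rainbow = ∧-conicalʳ (member X (σ [ v ]≔ true)) _ member+rainbow

    extends⇒block-missed : blockCount σ part (part v) ≡ 0
    extends⇒block-missed = ℕP.n≤0⇒n≡0 (ℕP.≤-pred (subst (_≤ 1) (blockCount-insert-own σ part v v∉σ)
      (member-Xnm⁻ part (σ [ v ]≔ true) (∧-conicalˡ _ (isRainbow (σ [ v ]≔ true)) member+rainbow) (part v))))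

    extends⇒colour-missed : blockCount σ col (col v) ≡ 0
    extends⇒colour-missed = ℕP.suc-injective (trans (sym (blockCount-insert-own σ col v v∉σ))
      (hasProfile⁻ (λ _ → 1) (σ [ v ]≔ true) rainbow (col v)))

    extends⇒colours≤1 : ∀ j → blockCount σ col j ≤ 1
    extends⇒colours≤1 j = subst (blockCount σ col j ≤_) (hasProfile⁻ (λ _ → 1) (σ [ v ]≔ true) rainbow j)
      (⊆ᵇ-∩-mono σ (σ [ v ]≔ true) (block col j) (⊆ᵇ-insert σ v))

  -- If σ extends at all, it misses exactly one colour and r + 1 blocks, and each (block, colour) class has q vertices.
  rainbow-extensions≤ : ∀ σ → member X σ ≡ true → ∣ σ ∣ ≡ suc k →
    ΣL (faces X (suc (suc k))) (λ τ → 𝟙 (isRainbow τ ∧ σ ⊆ᵇ τ)) ≤ q * suc r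
  rainbow-extensions≤ σ mσ ∣σ∣≡ rewrite rainbowExtensions≡∑ σ ∣σ∣≡ with ∑[ v < N ] 𝟙 (extends σ v) in total
  ... | zero = z≤n
  ... | suc _ with ∑-pos⇒∃ (λ v → 𝟙 (extends σ v)) (subst (0 <_) (sym total) (s≤s z≤n))
  ... | v₀ , 𝟙[σ+v₀]>0 = subst (_≤ q * suc r) total (begin
    ∑[ v < N ] 𝟙 (extends σ v)
      ≤⟨ ∑-mono-≤ (λ v → 𝟙-mono (λ σ+v → cong₂ _∧_ (≡⇒≡ᵇ-true _ 0 (extends⇒block-missed {σ} {v} σ+v))
                                                  (≡⇒≡ᵇ-true _ 0 (extends⇒colour-missed {σ} {v} σ+v)))) ⟩
    ∑[ v < N ] 𝟙 (missedBlock (part v) ∧ missedColour (col v))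
      ≡⟨ ∑-balanced part (suc k) q (λ i → trans (∣Vᵢ∣≡m i) m≡) missedBlock missedColour ⟩
    q * ∑[ i < suc n ] 𝟙 (missedBlock i) * ∑[ j < K ] 𝟙 (missedColour j)
      ≡⟨ cong₂ (λ a b → q * a * b) missed-blocks missed-colours ⟩
    q * suc r * 1
      ≡⟨ ℕP.*-identityʳ (q * suc r) ⟩
    q * suc r ∎)
    where
    open ℕP.≤-Reasoning
    missedBlock = λ i → blockCount σ part i ≡ᵇ 0
    missedColour = λ j → blockCount σ col j ≡ᵇ 0
    missed-blocks : ∑[ i < suc n ] 𝟙 (missedBlock i) ≡ suc r
    missed-blocks = ℕP.+-cancelʳ-≡ (suc k) _ (suc r) (begin-equality
      ∑[ i < suc n ] 𝟙 (missedBlock i) + suc k     ≡⟨ cong (∑[ i < suc n ] 𝟙 (missedBlock i) +_) (sym ∣σ∣≡) ⟩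
      ∑[ i < suc n ] 𝟙 (missedBlock i) + ∣ σ ∣     ≡⟨ missedBlocks+∣∣ σ part (member-Xnm⁻ part σ mσ) ⟩
      suc n                                         ≡⟨ cong suc (trans n≡ (trans (cong suc (ℕP.+-comm k r)) (sym (ℕP.+-suc r k)))) ⟩
      suc r + suc k                                 ∎)
    missed-colours : ∑[ j < K ] 𝟙 (missedColour j) ≡ 1
    missed-colours = ℕP.+-cancelʳ-≡ (suc k) _ 1
      (trans (cong (∑[ j < K ] 𝟙 (missedColour j) +_) (sym ∣σ∣≡))
             (missedBlocks+∣∣ σ col (extends⇒colours≤1 {σ} {v₀} (𝟙>0⇒true 𝟙[σ+v₀]>0))))

  φ : Cochain X
  φ = hasProfile allButLast

  cobd-φ≡isRainbow : ∀ {τ} → member X τ ≡ true → ∣ τ ∣ ≡ suc (suc k) → cobd X (suc k) φ τ ≡ isRainbow τ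
  cobd-φ≡isRainbow {τ} mτ ∣τ∣≡ = trans (cobd≡parity-facetCount X (Xnm-downClosed part) k φ mτ ∣τ∣≡) odd⇔rainbow
    where
    odd⇔rainbow : parity (facetCount allButLast τ) ≡ isRainbow τ
    odd⇔rainbow with isRainbow τ in rainbow
    ... | true = cong parity (rainbow⇒facetCount≡1 τ rainbow)
    ... | false with parity (facetCount allButLast τ) in odd
    ...   | false = refl
    ...   | true = contradiction (trans (sym (odd-facetCount⇒rainbow τ odd)) rainbow) (λ ())

  rainbowFaces : List (Subset N)
  rainbowFaces = filterᵇ isRainbow (faces X (suc (suc k)))

  -- Each rainbow face contains a k-face of the support of φ′, and a k-face lies in at most q(r+1) rainbow faces.
  double-count : ∀ φ′ → (∀ {τ} → τ ∈ faces X (suc (suc k)) → cobd X (suc k) φ′ τ ≡ isRainbow τ) →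
    length rainbowFaces * K ≤ length (filterᵇ φ′ (faces X (suc k))) * (m * suc r)
  double-count φ′ dφ′≡ = begin
    length rainbowFaces * K
      ≤⟨ ℕP.*-monoˡ-≤ K (subst (_≤ ΣL rainbowFaces (λ τ → ΣL S (λ σ → 𝟙 (σ ⊆ᵇ τ)))) (sym (length≡ΣL-1 rainbowFaces))
                                (ΣL-mono-∈ rainbowFaces covered)) ⟩
    ΣL rainbowFaces (λ τ → ΣL S (λ σ → 𝟙 (σ ⊆ᵇ τ))) * K
      ≡⟨ cong (_* K) (ΣL-comm rainbowFaces S (λ τ σ → 𝟙 (σ ⊆ᵇ τ))) ⟩
    ΣL S (λ σ → ΣL rainbowFaces (λ τ → 𝟙 (σ ⊆ᵇ τ))) * K
      ≡⟨ trans (ℕP.*-comm (ΣL S (λ σ → ΣL rainbowFaces (λ τ → 𝟙 (σ ⊆ᵇ τ)))) K)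
               (sym (ΣL-distribˡ-* S K (λ σ → ΣL rainbowFaces (λ τ → 𝟙 (σ ⊆ᵇ τ))))) ⟩
    ΣL S (λ σ → K * ΣL rainbowFaces (λ τ → 𝟙 (σ ⊆ᵇ τ)))
      ≤⟨ ΣL-mono-∈ S extensions ⟩
    ΣL S (λ _ → m * suc r)
      ≡⟨ ΣL-const S (m * suc r) ⟩
    length S * (m * suc r) ∎
    where
    open ℕP.≤-Reasoning
    S = filterᵇ φ′ (faces X (suc k))
    covered : ∀ {τ} → τ ∈ rainbowFaces → 1 ≤ ΣL S (λ σ → 𝟙 (σ ⊆ᵇ τ))
    covered {τ} τ∈ = parity-true⇒pos (
      trans (cong parity (ΣL-filterᵇ-𝟙 φ′ (faces X (suc k)) (_⊆ᵇ τ)))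
      (trans (sym (xorSum≡parity (faces X (suc k)) (λ σ → φ′ σ ∧ σ ⊆ᵇ τ)))
      (trans (dφ′≡ (proj₂ (∈-filterᵇ⁻ isRainbow (faces X (suc (suc k))) τ∈)))
             (proj₁ (∈-filterᵇ⁻ isRainbow (faces X (suc (suc k))) τ∈)))))
    extensions : ∀ {σ} → σ ∈ S → K * ΣL rainbowFaces (λ τ → 𝟙 (σ ⊆ᵇ τ)) ≤ m * suc r
    extensions {σ} σ∈ = let mσ , ∣σ∣≡ = ∈-faces⁻ X (proj₂ (∈-filterᵇ⁻ φ′ _ σ∈)) in begin
      K * ΣL rainbowFaces (λ τ → 𝟙 (σ ⊆ᵇ τ))
        ≡⟨ cong (K *_) (ΣL-filterᵇ-𝟙 isRainbow (faces X (suc (suc k))) (σ ⊆ᵇ_)) ⟩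
      K * ΣL (faces X (suc (suc k))) (λ τ → 𝟙 (isRainbow τ ∧ σ ⊆ᵇ τ))
        ≤⟨ ℕP.*-monoʳ-≤ K (rainbow-extensions≤ σ mσ ∣σ∣≡) ⟩
      K * (q * suc r)
        ≡⟨ trans (*-reorder K q (suc r)) (cong (_* suc r) (sym m≡)) ⟩
      m * suc r ∎
      where
      *-reorder : ∀ x y z → x * (y * z) ≡ y * x * z
      *-reorder = solve-∀

  module _ (1≤q : 1 ≤ q) where

    K≤m : K ≤ m
    K≤m = subst (K ≤_) (sym m≡) (subst (_≤ q * K) (ℕP.*-identityˡ K) (ℕP.*-monoˡ-≤ K 1≤q))

    1≤m : 1 ≤ m
    1≤m = ℕP.≤-trans (s≤s z≤n) K≤m

    K≤n+1 : K ≤ suc n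
    K≤n+1 = s≤s (subst (suc k ≤_) (sym n≡) (s≤s (ℕP.m≤m+n k r)))

    private
      W : ℕ → ℕ
      W = weightDenominator part ∣Vᵢ∣≡m
      F₂ = faces X (suc (suc k))

    norm-rainbow : ∀ ψ → (∀ {τ} → τ ∈ F₂ → ψ τ ≡ isRainbow τ) →
      norm X (suc (suc k)) ψ ≡ (length rainbowFaces * m ^ r) /suc ℕ.pred (W (suc (suc k)))
    norm-rainbow ψ ψ≡ = trans (norm-Xnm part ∣Vᵢ∣≡m 1≤m (suc (suc k)) r ψ (sym k+2+r≡n+1))
                              (cong (λ D → (length D * m ^ r) /suc ℕ.pred (W (suc (suc k)))) (filterᵇ-cong-∈ F₂ ψ≡))
      where
      k+2+r≡n+1 : suc n ≡ suc (suc k) + r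
      k+2+r≡n+1 = cong suc n≡

    -- Multiplying double-count by m^r f_n(X), the identity C(n+1, k+2) (k+2) = C(n+1, k+1) (r+1)
    -- turns it into the comparison of the weighted sums.
    rainbow-norm≤ : ∀ φ′ → (∀ {τ} → τ ∈ F₂ → cobd X (suc k) φ′ τ ≡ isRainbow τ) →
      (length rainbowFaces * m ^ r) /suc ℕ.pred (W (suc (suc k))) ℚ.≤ norm X (suc k) φ′
    rainbow-norm≤ φ′ dφ′≡ = subst ((length rainbowFaces * m ^ r) /suc ℕ.pred (W (suc (suc k))) ℚ.≤_)
      (sym (norm-Xnm part ∣Vᵢ∣≡m 1≤m (suc k) (suc r) φ′ (cong suc (trans (ℕP.+-suc k r) (sym n≡)))))
      (/suc-mono-≤ (length rainbowFaces * m ^ r) (length S * m ^ suc r) (ℕ.pred (W (suc (suc k)))) (ℕ.pred (W (suc k)))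
       (subst₂ (λ x y → length rainbowFaces * m ^ r * x ≤ length S * (m * m ^ r) * y)
        (sym (suc-pred (suc k) (ℕP.<⇒≤ K≤n+1))) (sym (suc-pred (suc (suc k)) K≤n+1))
        (cross-multiply (length rainbowFaces) (length S) K m (m ^ r) (m ^ suc n) (suc n C suc k) (suc n C suc (suc k)) r
          absorption (double-count φ′ dφ′≡))))
      where
      S = filterᵇ φ′ (faces X (suc k))
      absorption : (suc n C suc k) * suc r ≡ (suc n C suc (suc k)) * K
      absorption = sym (trans (nC[k+1]*[k+1]≡nCk*[n∸k] (suc n) (suc k)) (cong ((suc n C suc k) *_) n∸k≡r+1))
        where
        n∸k≡r+1 : n ∸ k ≡ suc r
        n∸k≡r+1 = trans (cong (_∸ k) (trans n≡ (sym (ℕP.+-suc k r)))) (ℕP.m+n∸m≡n k (suc r))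
      suc-pred : ∀ s → s ≤ suc n → suc (ℕ.pred (W s)) ≡ W s
      suc-pred s s≤ = ℕP.suc-pred (W s) {{ℕ.>-nonZero (1≤weightDenominator part ∣Vᵢ∣≡m 1≤m s s≤)}}

    h≤1-Xnm : h X k ≤∞ fin 1ℚ
    h≤1-Xnm = h≤1-by-witness X (Xnm-downClosed part) k φ₀ φ₀∈ φ₀∉B ‖dφ₀‖>0 ‖dφ₀‖≤
      where
      representative = enumerated-representative X (faces X (suc k)) φ
      φ₀ = proj₁ representative
      φ₀∈ = proj₁ (proj₂ representative)
      dφ₀≡rainbow : ∀ {τ} → τ ∈ F₂ → cobd X (suc k) φ₀ τ ≡ isRainbow τ
      dφ₀≡rainbow {τ} τ∈ = let mτ , ∣τ∣≡ = ∈-faces⁻ X τ∈ in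
        trans (cobd-cong-∈ X (suc k) (proj₂ (proj₂ representative)) τ) (cobd-φ≡isRainbow mτ ∣τ∣≡)
      D = diagonal part ∣Vᵢ∣≡m K
      D∈F₂ : D ∈ F₂
      D∈F₂ = ∈-faces⁺ X (member-diagonal part ∣Vᵢ∣≡m K≤m) (∣diagonal∣ part ∣Vᵢ∣≡m K≤m K≤n+1)
      D-rainbow : isRainbow D ≡ true
      D-rainbow = diagonal-rainbow part ∣Vᵢ∣≡m (suc k) K≤m K≤n+1
      φ₀∉B : inB X k φ₀ ≡ false
      φ₀∉B = nonzero-cobd⇒¬inB X (Xnm-downClosed part) k φ₀
        (member-diagonal part ∣Vᵢ∣≡m K≤m) (∣diagonal∣ part ∣Vᵢ∣≡m K≤m K≤n+1)
        (trans (dφ₀≡rainbow D∈F₂) D-rainbow)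
      ‖dφ₀‖>0 : 0ℚ ℚ.< norm X (suc (suc k)) (cobd X (suc k) φ₀)
      ‖dφ₀‖>0 = subst (0ℚ ℚ.<_) (sym (norm-rainbow (cobd X (suc k) φ₀) dφ₀≡rainbow))
        (/suc-pos _ _ (ℕP.*-mono-≤ (∈⇒length>0 (∈-filterᵇ⁺ isRainbow F₂ D∈F₂ D-rainbow)) (ℕP.m^n>0 m {{ℕ.>-nonZero 1≤m}} r)))
      ‖dφ₀‖≤ : ∀ φ′ → (∀ {τ} → τ ∈ F₂ → cobd X (suc k) φ′ τ ≡ cobd X (suc k) φ₀ τ) →
        norm X (suc (suc k)) (cobd X (suc k) φ₀) ℚ.≤ norm X (suc k) φ′
      ‖dφ₀‖≤ φ′ dφ′≡ = subst (ℚ._≤ norm X (suc k) φ′) (sym (norm-rainbow (cobd X (suc k) φ₀) dφ₀≡rainbow))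
        (rainbow-norm≤ φ′ (λ τ∈ → trans (dφ′≡ τ∈) (dφ₀≡rainbow τ∈)))

-- 1 ≤ n is implied by k < n.
claim3p4 : (n m : ℕ) → 1 ≤ n → 1 ≤ m →
    (N : ℕ) (part : Fin N → Fin (suc n)) →
    (∀ i → ∣ block part i ∣ ≡ m) →
    (k : ℕ) → k < n → suc (suc k) ∣ m →
    h (Xnm n N part) k ≤∞ fin 1ℚ
claim3p4 n m _ 1≤m N part ∣Vᵢ∣≡m k k<n (divides q m≡q*K) = Construction.h≤1-Xnm part ∣Vᵢ∣≡m n≡ m≡q*K 1≤q
  where
  r = proj₁ (ℕP.m≤n⇒∃[o]m+o≡n k<n)
  n≡ : n ≡ suc (k + r)
  n≡ = sym (proj₂ (ℕP.m≤n⇒∃[o]m+o≡n k<n))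
  1≤q : 1 ≤ q
  1≤q = ℕP.n≢0⇒n>0 λ q≡0 → ℕP.<⇒≢ 1≤m (sym (trans m≡q*K (cong (_* suc (suc k)) q≡0)))
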